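{- Let $\Phi$ be a root system of type $E_7$, $E_8$, or $D_n$ with $n\ge4$ even, of rank $n$, let $V$ be its reflection representation, and let $R\subseteq\Phi_+$ be a set of $n$ pairwise orthogonal positive roots (an orthogonal basis of $V$). (i) If $\beta\in\Phi_+\setminus R$, then $\beta$ is orthogonal to all but four elements $Q=\{\beta_1,\beta_2,\beta_3,\beta_4\}$ of $R$. Moreover, $\beta=(\pm\beta_1\pm\beta_2\pm\beta_3\pm\beta_4)/2$ for suitable signs; the set $\Psi_Q:=Q\cup(-Q)\cup\{(\pm\beta_1\pm\beta_2\pm\beta_3\pm\beta_4)/2\}$ (all sign choices) is a subset of $\Phi$ forming a subsystem of type $D_4$; and $\Psi_Q$ is the smallest subsystem of $\Phi$ containing both $Q$ and $\beta$. (ii) For a subset $Q\subseteq R$, the following are equivalent: (a) $\sum_{\beta\in Q}\beta=2\alpha$ for some root $\alpha$; (b) $Q$ is the support, with respect to the basis $R$, of some root $\alpha\in\Phi\setminus(R\cup-R)$; (c) $Q\in D_4(R)$; (d) $Q=\Psi\cap R$ for some $\Psi\in\mathcal Q(R)$. (iii) The maps $\phi:D_4(R)\to\mathcal Q(R)$, $Q\mapsto\mathrm{Span}(Q)\cap\Phi$, and $\psi:\mathcal Q(R)\to D_4(R)$, $\Psi\mapsto\Psi\cap R$, are mutually inverse. Every root $\alpha\in\Phi\setminus(R\cup-R)$ lies in $\mathrm{Span}(Q)$ for a unique $Q\in D_4(R)$, namely the support of $\alpha$ with respect to $R$.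
   Context: $\Phi$ is a simply laced root system with invariant form $B$ ($B(\alpha,\alpha)=2$ for roots), two roots orthogonal if $B=0$; $\Phi_+$ its positive roots; a subsystem is a nonempty subset closed under all reflections $s_\alpha(\beta)=\beta-B(\alpha,\beta)\alpha$ with $\alpha$ in it. For a set $R$ of pairwise orthogonal positive roots and $4\le k\le|R|$, $D_k(R)=\{H\subseteq R:|H|=k\text{ and }\mathrm{Span}(H)\cap\Phi\text{ is a subsystem of type }D_k\}$, and $\mathcal Q(R)$ is the set of $D_4$-subsystems $\Psi$ of $\Phi$ with $\Psi\cap R\in D_4(R)$. The support of a vector with respect to the basis $R$ is the set of elements of $R$ with nonzero coefficient. -}

module Defs where

open import Data.Nat as ℕ using (ℕ; zero; suc; _≤_)
open import Data.Nat.Divisibility using (_∣_)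
open import Data.Fin using (Fin; zero; suc)
open import Data.Fin.Subset using (Subset; _∈_; _∉_; ∣_∣; inside; outside)
open import Data.Vec using (Vec; []; _∷_; lookup; replicate; zipWith; map; foldr)
open import Data.Rational as ℚ using (ℚ; 0ℚ; 1ℚ; ½; -½)
open import Data.Sign using (Sign)
open import Data.Product using (Σ; ∃; ∃-syntax; _×_; _,_)
open import Data.Sum using (_⊎_)
open import Data.Unit using (⊤)
open import Data.Empty using (⊥)
open import Relation.Binary.PropositionalEquality using (_≡_; _≢_)
open import Relation.Nullary using (¬_)
open import Function.Bundles using (_⇔_)

V : ℕ → Set
V m = Vec ℚ m

infixl 6 _⊕_ _⊖_
infixl 7 _·_

_⊕_ : ∀ {m} → V m → V m → V m
_⊕_ = zipWith ℚ._+_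

_·_ : ∀ {m} → ℚ → V m → V m
c · v = map (c ℚ.*_) v

neg : ∀ {m} → V m → V m
neg v = map ℚ.-_ v

_⊖_ : ∀ {m} → V m → V m → V m
u ⊖ v = u ⊕ neg v

𝟘 : ∀ {m} → V m
𝟘 = replicate _ 0ℚ

B : ∀ {m} → V m → V m → ℚ
B u v = foldr _ ℚ._+_ 0ℚ (zipWith ℚ._*_ u v)

e : ∀ {m} → Fin m → V m
e zero    = 1ℚ ∷ 𝟘
e (suc i) = 0ℚ ∷ e i

sgn : Sign → ℚ
sgn Sign.+ = 1ℚ
sgn Sign.- = ℚ.- 1ℚ

refl-s : ∀ {m} → V m → V m → V m
refl-s α β = β ⊖ (B α β · α)

lincomb : ∀ {n m} → (Fin n → V m) → (Fin n → ℚ) → V m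
lincomb {zero}  R c = 𝟘
lincomb {suc n} R c = (c zero · R zero) ⊕ lincomb (λ i → R (suc i)) (λ i → c (suc i))

VSet : ℕ → Set₁
VSet m = V m → Set

_≐_ : ∀ {m} → VSet m → VSet m → Set
P ≐ Q = ∀ v → P v ⇔ Q v

_⊆ᵥ_ : ∀ {m} → VSet m → VSet m → Set
P ⊆ᵥ Q = ∀ v → P v → Q v

-- Concrete root systems E₇, E₈, D_n (standard models, B(α,α)=2)

data Kind : Set where
  E₇ E₈ : Kind
  D     : ℕ → Kind

Admissible : Kind → Set
Admissible E₇    = ⊤
Admissible E₈    = ⊤
Admissible (D n) = 4 ≤ n × 2 ∣ n

dim : Kind → ℕ
dim E₇    = 8
dim E₈    = 8
dim (D n) = n

rank : Kind → ℕ
rank E₇    = 7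
rank E₈    = 8
rank (D n) = n

DRoot : ∀ {m} → VSet m
DRoot {m} v = Σ (Fin m) λ i → Σ (Fin m) λ j → i ≢ j ×
              Σ Sign λ s → Σ Sign λ t → v ≡ (sgn s · e i) ⊕ (sgn t · e j)

minusCount : ∀ {m} → (Fin m → Sign) → ℕ
minusCount {zero}  ε = 0
minusCount {suc m} ε with ε zero
... | Sign.- = suc (minusCount (λ i → ε (suc i)))
... | Sign.+ = minusCount (λ i → ε (suc i))

halfSigns : ∀ {m} → (Fin m → Sign) → V m
halfSigns ε = lincomb e (λ i → ½ ℚ.* sgn (ε i))

E8Root : VSet 8
E8Root v = DRoot v ⊎ (Σ (Fin 8 → Sign) λ ε → 2 ∣ minusCount ε × v ≡ halfSigns ε)

ω : V 8
ω = e (suc (suc (suc (suc (suc (suc zero)))))) ⊕ e (suc (suc (suc (suc (suc (suc (suc zero)))))))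

-- E₇ = roots of E₈ orthogonal to a fixed root
E7Root : VSet 8
E7Root v = E8Root v × B v ω ≡ 0ℚ

Φ : (K : Kind) → VSet (dim K)
Φ E₇    = E7Root
Φ E₈    = E8Root
Φ (D n) = DRoot

-- positive roots: lexicographically positive (first nonzero coordinate > 0)
data LexPos : ∀ {m} → V m → Set where
  here  : ∀ {m x} {v : V m} → 0ℚ ℚ.< x → LexPos (x ∷ v)
  there : ∀ {m x} {v : V m} → x ≡ 0ℚ → LexPos v → LexPos (x ∷ v)

Φ₊ : (K : Kind) → VSet (dim K)
Φ₊ K v = Φ K v × LexPos v

IsSubsystem : ∀ {m} → VSet m → VSet m → Set
IsSubsystem Φ' Ψ = (Ψ ⊆ᵥ Φ') × (∃ λ v → Ψ v) ×
                   (∀ α β → Ψ α → Ψ β → Ψ (refl-s α β))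

IsTypeD : ∀ {m} → ℕ → VSet m → Set
IsTypeD {m} k Ψ = Σ (Fin k → V m) λ ε →
  (∀ i → B (ε i) (ε i) ≡ 1ℚ) × (∀ i j → i ≢ j → B (ε i) (ε j) ≡ 0ℚ) ×
  (Ψ ≐ λ v → Σ (Fin k) λ i → Σ (Fin k) λ j → i ≢ j ×
              Σ Sign λ s → Σ Sign λ t → v ≡ (sgn s · ε i) ⊕ (sgn t · ε j))

SubsystemOfTypeD : ∀ {m} → VSet m → ℕ → VSet m → Set
SubsystemOfTypeD Φ' k Ψ = IsSubsystem Φ' Ψ × IsTypeD k Ψ

-- Notions relative to R = (R_i)_{i < n}, subsets of R as Subset n

module _ {n m : ℕ} (R : Fin n → V m) where

  InSpan : Subset n → VSet m
  InSpan H v = Σ (Fin n → ℚ) λ c → (∀ i → i ∉ H → c i ≡ 0ℚ) × v ≡ lincomb R c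

  SpanΦ : VSet m → Subset n → VSet m
  SpanΦ Φ' H v = Φ' v × InSpan H v

  IsSupport : V m → Subset n → Set
  IsSupport v H = Σ (Fin n → ℚ) λ c → v ≡ lincomb R c ×
                  (∀ i → (i ∈ H → c i ≢ 0ℚ) × (c i ≢ 0ℚ → i ∈ H))

  IsMeetR : VSet m → Subset n → Set
  IsMeetR Ψ H = ∀ i → (i ∈ H → Ψ (R i)) × (Ψ (R i) → i ∈ H)

  indicator : Subset n → Fin n → ℚ
  indicator H i with lookup H i
  ... | inside  = 1ℚ
  ... | outside = 0ℚ

  sumR : Subset n → V m
  sumR H = lincomb R (indicator H)

  halfSumR : Subset n → (Fin n → Sign) → V m
  halfSumR H ε = lincomb R (λ i → ½ ℚ.* (indicator H i ℚ.* sgn (ε i)))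

  InR± : VSet m
  InR± v = Σ (Fin n) λ i → v ≡ R i ⊎ v ≡ neg (R i)

  ΨQ : Subset n → VSet m
  ΨQ Q v = (Σ (Fin n) λ i → i ∈ Q × (v ≡ R i ⊎ v ≡ neg (R i)))
         ⊎ (Σ (Fin n → Sign) λ ε → v ≡ halfSumR Q ε)

  module _ (Φ' : VSet m) where

    Dk : ℕ → Subset n → Set
    Dk k H = ∣ H ∣ ≡ k × SubsystemOfTypeD Φ' k (SpanΦ Φ' H)

    𝒬 : VSet m → Set
    𝒬 Ψ = SubsystemOfTypeD Φ' 4 Ψ × Σ (Subset n) λ H → IsMeetR Ψ H × Dk 4 H

2ℚ· : ∀ {m} → V m → V m
2ℚ· α = α ⊕ α

module Submission where

-- Write roots in the orthogonal basis R. As B (R i) (R i) = 2, a root α has coordinates ½ B(α, R i); if α ∉ ±R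
-- these pairings lie in {-1, 0, 1}, and 2 = B(α, α) = ½ Σᵢ B(α, R i)² forces exactly four of them to be nonzero.
-- Hence α = ½(±β₁ ± β₂ ± β₃ ± β₄) for its support Q = {β₁, …, β₄}. The reflection in βₖ flips the k-th sign, so
-- every subsystem containing Q and α contains all sixteen half-sums; together with ±Q they are the image of the
-- 24 Hurwitz units under eₖ ↦ βₖ, a root system of type D₄, and they exhaust Span(Q) ∩ Φ. Parts (ii) and (iii)
-- follow, since every D₄ inside Span(Q) ∩ Φ contains a root outside ±R, and the support of such a root is Q.
-- Only four properties of Φ are used: roots have norm 2, pair into {-2, …, 2}, and are closed under negation and
-- under adding two roots with pairing -1. They hold in the coordinate models of Dₙ, E₈ and E₇ by direct computation.

open import Defs
open import Algebra.Bundles using (CommutativeRing)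
open import Data.Nat as ℕ using (ℕ; zero; suc; s≤s)
open import Data.Nat.Divisibility using (_∣_; divides; ∣m∣n⇒∣m+n; ∣m+n∣m⇒∣n; m∣m*n)
import Data.Nat.Properties as ℕₚ
open import Data.Fin as Fin using (Fin; zero; suc; punchIn)
import Data.Fin.Properties as Finₚ
import Data.Fin.Subset.Properties as Subsetₚ
open import Data.Fin.Subset using (Subset; _∈_; _∉_; _⊆_; ∣_∣; inside; outside)
open import Data.Vec as Vec using ([]; _∷_; lookup; replicate)
import Data.Vec.Properties as Vecₚ
open import Data.Vec.Functional using (insertAt)
open import Data.Vec.Functional.Properties using (insertAt-lookup; insertAt-punchIn)
open import Data.Rational as ℚ using (ℚ; 0ℚ; 1ℚ; ½)
import Data.Rational.Properties as ℚₚ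
open import Data.Rational.Solver using (module +-*-Solver)
open import Data.Sign.Base as Sign using (Sign; opposite)
import Data.Sign.Properties as Signₚ
open import Data.Product using (Σ; ∃; _×_; _,_; proj₁; proj₂)
open import Data.Sum using (_⊎_; inj₁; inj₂)
open import Data.Empty using (⊥; ⊥-elim)
open import Function using (_∘_; case_of_)
open import Function.Bundles using (_⇔_; mk⇔; Equivalence)
open import Relation.Nullary using (¬_; ¬?; Dec; yes; no; does)
open import Data.Bool using (if_then_else_)
open import Relation.Nullary.Decidable using (toWitness; _×-dec_; _⊎-dec_; _→-dec_)
open import Relation.Binary.PropositionalEquality
open import Relation.Binary.Definitions using (tri<; tri≈; tri>)
open import Algebra.Properties.CommutativeMonoid.Sum ℚₚ.+-0-commutativeMonoid
  using (sum; sum-cong-≗; sum-remove; sum-replicate-zero)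
open import Algebra.Properties.Group ℚₚ.+-0-group using () renaming (∙-cancelˡ to +-cancelˡ)
open import Algebra.Properties.Semiring.Sum (CommutativeRing.semiring ℚₚ.+-*-commutativeRing)
  using (*-distribˡ-sum)

open +-*-Solver using (solve; _:=_; _:+_; _:*_; :-_; _:-_; con)
open ≡-Reasoning

2ℚ : ℚ
2ℚ = 1ℚ ℚ.+ 1ℚ

ℚ-neg-involutive : ∀ x → ℚ.- (ℚ.- x) ≡ x
ℚ-neg-involutive = solve 1 (λ x → :- (:- x) := x) refl

*-cancelʳ-≢0 : ∀ x y → x ℚ.* y ≡ 0ℚ → y ≢ 0ℚ → x ≡ 0ℚ
*-cancelʳ-≢0 x y xy≡0 y≢0 = begin
  x                    ≡⟨ sym (ℚₚ.*-identityʳ x) ⟩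
  x ℚ.* 1ℚ             ≡⟨ cong (x ℚ.*_) (sym (ℚₚ.*-inverseʳ y)) ⟩
  x ℚ.* (y ℚ.* 1/y)    ≡⟨ sym (ℚₚ.*-assoc x y 1/y) ⟩
  x ℚ.* y ℚ.* 1/y      ≡⟨ cong (ℚ._* 1/y) xy≡0 ⟩
  0ℚ ℚ.* 1/y           ≡⟨ ℚₚ.*-zeroˡ 1/y ⟩
  0ℚ                   ∎
  where
  instance _ = ℚ.≢-nonZero y≢0
  1/y = ℚ.1/ y

≡2⇒≢0 : ∀ {x} → x ≡ 2ℚ → x ≢ 0ℚ
≡2⇒≢0 refl ()

½*x≡0⇒x≡0 : ∀ x → ½ ℚ.* x ≡ 0ℚ → x ≡ 0ℚ
½*x≡0⇒x≡0 x ½x≡0 = *-cancelʳ-≢0 x ½ (trans (ℚₚ.*-comm x ½) ½x≡0) λ ()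

x≡0⊎0<x*x : ∀ x → x ≡ 0ℚ ⊎ 0ℚ ℚ.< x ℚ.* x
x≡0⊎0<x*x x with ℚₚ.<-cmp x 0ℚ
... | tri< x<0 _ _ = inj₂ (ℚₚ.positive⁻¹ _ {{ℚₚ.neg*neg⇒pos x {{ℚ.negative x<0}} x {{ℚ.negative x<0}}}})
... | tri≈ _ x≡0 _ = inj₁ x≡0
... | tri> _ _ x>0 = inj₂ (ℚₚ.positive⁻¹ _ {{ℚₚ.pos*pos⇒pos x {{ℚ.positive x>0}} x {{ℚ.positive x>0}}}})

0≤x*x : ∀ x → 0ℚ ℚ.≤ x ℚ.* x
0≤x*x x with x≡0⊎0<x*x x
... | inj₁ refl = ℚₚ.≤-refl
... | inj₂ 0<x*x = ℚₚ.<⇒≤ 0<x*x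

⊕-comm : ∀ {m} (u v : V m) → u ⊕ v ≡ v ⊕ u
⊕-comm = Vecₚ.zipWith-comm ℚₚ.+-comm

⊕-assoc : ∀ {m} (u v w : V m) → (u ⊕ v) ⊕ w ≡ u ⊕ (v ⊕ w)
⊕-assoc = Vecₚ.zipWith-assoc ℚₚ.+-assoc

⊕-identityˡ : ∀ {m} (u : V m) → 𝟘 ⊕ u ≡ u
⊕-identityˡ = Vecₚ.zipWith-identityˡ ℚₚ.+-identityˡ

⊕-identityʳ : ∀ {m} (u : V m) → u ⊕ 𝟘 ≡ u
⊕-identityʳ = Vecₚ.zipWith-identityʳ ℚₚ.+-identityʳ

⊖-self : ∀ {m} (u : V m) → u ⊖ u ≡ 𝟘
⊖-self = Vecₚ.zipWith-inverseʳ ℚₚ.+-inverseʳ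

⊕-interchange : ∀ {m} (a b c d : V m) → (a ⊕ b) ⊕ (c ⊕ d) ≡ (a ⊕ c) ⊕ (b ⊕ d)
⊕-interchange [] [] [] [] = refl
⊕-interchange (a ∷ as) (b ∷ bs) (c ∷ cs) (d ∷ ds) = cong₂ _∷_
  (solve 4 (λ a b c d → (a :+ b) :+ (c :+ d) := (a :+ c) :+ (b :+ d)) refl a b c d)
  (⊕-interchange as bs cs ds)

·-distribˡ-⊕ : ∀ {m} a (u v : V m) → a · (u ⊕ v) ≡ a · u ⊕ a · v
·-distribˡ-⊕ a [] [] = refl
·-distribˡ-⊕ a (x ∷ u) (y ∷ v) = cong₂ _∷_ (ℚₚ.*-distribˡ-+ a x y) (·-distribˡ-⊕ a u v)

·-distribʳ-+ : ∀ {m} a b (u : V m) → (a ℚ.+ b) · u ≡ a · u ⊕ b · u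
·-distribʳ-+ a b [] = refl
·-distribʳ-+ a b (x ∷ u) = cong₂ _∷_ (ℚₚ.*-distribʳ-+ x a b) (·-distribʳ-+ a b u)

·-assoc : ∀ {m} a b (u : V m) → a · (b · u) ≡ (a ℚ.* b) · u
·-assoc a b u = trans (sym (Vecₚ.map-∘ (a ℚ.*_) (b ℚ.*_) u)) (Vecₚ.map-cong (sym ∘ ℚₚ.*-assoc a b) u)

·-identityˡ : ∀ {m} (u : V m) → 1ℚ · u ≡ u
·-identityˡ u = trans (Vecₚ.map-cong ℚₚ.*-identityˡ u) (Vecₚ.map-id u)

·-zeroˡ : ∀ {m} (u : V m) → 0ℚ · u ≡ 𝟘
·-zeroˡ u = trans (Vecₚ.map-cong ℚₚ.*-zeroˡ u) (Vecₚ.map-const u 0ℚ)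

·-zeroʳ : ∀ {m} a → a · 𝟘 {m} ≡ 𝟘
·-zeroʳ {m} a = trans (Vecₚ.map-replicate (a ℚ.*_) 0ℚ m) (cong (replicate m) (ℚₚ.*-zeroʳ a))

neg≡-1· : ∀ {m} (u : V m) → neg u ≡ (ℚ.- 1ℚ) · u
neg≡-1· = Vecₚ.map-cong λ x → solve 1 (λ x → :- x := con (ℚ.- 1ℚ) :* x) refl x

neg-· : ∀ {m} a (u : V m) → neg (a · u) ≡ (ℚ.- a) · u
neg-· a u = trans (sym (Vecₚ.map-∘ ℚ.-_ (a ℚ.*_) u)) (Vecₚ.map-cong (ℚₚ.neg-distribˡ-* a) u)

neg-distrib-⊕ : ∀ {m} (u v : V m) → neg (u ⊕ v) ≡ neg u ⊕ neg v
neg-distrib-⊕ [] [] = refl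
neg-distrib-⊕ (x ∷ u) (y ∷ v) = cong₂ _∷_ (ℚₚ.neg-distrib-+ x y) (neg-distrib-⊕ u v)

⊕≡𝟘⇒≡neg : ∀ {m} (u v : V m) → u ⊕ v ≡ 𝟘 → u ≡ neg v
⊕≡𝟘⇒≡neg [] [] _ = refl
⊕≡𝟘⇒≡neg (x ∷ u) (y ∷ v) eq = cong₂ _∷_ x≡-y (⊕≡𝟘⇒≡neg u v (cong Vec.tail eq))
  where
  x≡-y : x ≡ ℚ.- y
  x≡-y = begin
    x                        ≡⟨ solve 2 (λ x y → x := (x :+ y) :- y) refl x y ⟩
    (x ℚ.+ y) ℚ.- y          ≡⟨ cong (ℚ._- y) (cong Vec.head eq) ⟩
    0ℚ ℚ.- y                 ≡⟨ ℚₚ.+-identityˡ (ℚ.- y) ⟩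
    ℚ.- y                    ∎

neg-involutive : ∀ {m} (u : V m) → neg (neg u) ≡ u
neg-involutive u = begin
  neg (neg u)           ≡⟨ sym (Vecₚ.map-∘ ℚ.-_ ℚ.-_ u) ⟩
  Vec.map (ℚ.-_ ∘ ℚ.-_) u ≡⟨ Vecₚ.map-cong ℚ-neg-involutive u ⟩
  Vec.map (λ x → x) u   ≡⟨ Vecₚ.map-id u ⟩
  u                     ∎

half-double : ∀ {m} (u : V m) → ½ · (u ⊕ u) ≡ u
half-double [] = refl
half-double (x ∷ u) = cong₂ _∷_ (solve 1 (λ x → con ½ :* (x :+ x) := x) refl x) (half-double u)

⊖≡𝟘⇒≡ : ∀ {m} (u v : V m) → u ⊖ v ≡ 𝟘 → u ≡ v
⊖≡𝟘⇒≡ u v eq = trans (⊕≡𝟘⇒≡neg u (neg v) eq) (neg-involutive v)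

⊖-0· : ∀ {m} (u v : V m) → u ⊖ 0ℚ · v ≡ u
⊖-0· [] [] = refl
⊖-0· (x ∷ u) (y ∷ v) = cong₂ _∷_ (solve 2 (λ x y → x :+ :- (con 0ℚ :* y) := x) refl x y) (⊖-0· u v)

⊖-1· : ∀ {m} (u v : V m) → u ⊖ 1ℚ · v ≡ u ⊕ neg v
⊖-1· [] [] = refl
⊖-1· (x ∷ u) (y ∷ v) = cong₂ _∷_ (solve 2 (λ x y → x :+ :- (con 1ℚ :* y) := x :+ :- y) refl x y) (⊖-1· u v)

⊖-[-1]· : ∀ {m} (u v : V m) → u ⊖ (ℚ.- 1ℚ) · v ≡ u ⊕ v
⊖-[-1]· [] [] = refl
⊖-[-1]· (x ∷ u) (y ∷ v) = cong₂ _∷_ (solve 2 (λ x y → x :+ :- (con (ℚ.- 1ℚ) :* y) := x :+ y) refl x y) (⊖-[-1]· u v)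

⊖-2·-self : ∀ {m} (u : V m) → u ⊖ 2ℚ · u ≡ neg u
⊖-2·-self [] = refl
⊖-2·-self (x ∷ u) = cong₂ _∷_ (solve 1 (λ x → x :+ :- ((con 1ℚ :+ con 1ℚ) :* x) := :- x) refl x) (⊖-2·-self u)

⊖-[-2]·-neg : ∀ {m} (u : V m) → u ⊖ (ℚ.- 2ℚ) · neg u ≡ neg u
⊖-[-2]·-neg [] = refl
⊖-[-2]·-neg (x ∷ u) = cong₂ _∷_ (solve 1 (λ x → x :+ :- (:- (con 1ℚ :+ con 1ℚ) :* (:- x)) := :- x) refl x) (⊖-[-2]·-neg u)

B-comm : ∀ {m} (u v : V m) → B u v ≡ B v u
B-comm [] [] = refl
B-comm (x ∷ u) (y ∷ v) = cong₂ ℚ._+_ (ℚₚ.*-comm x y) (B-comm u v)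

B-⊕ˡ : ∀ {m} (u v w : V m) → B (u ⊕ v) w ≡ B u w ℚ.+ B v w
B-⊕ˡ [] [] [] = refl
B-⊕ˡ (x ∷ u) (y ∷ v) (z ∷ w) = trans (cong ((x ℚ.+ y) ℚ.* z ℚ.+_) (B-⊕ˡ u v w))
  (solve 5 (λ x y z a b → (x :+ y) :* z :+ (a :+ b) := (x :* z :+ a) :+ (y :* z :+ b))
     refl x y z (B u w) (B v w))

B-·ˡ : ∀ {m} a (u w : V m) → B (a · u) w ≡ a ℚ.* B u w
B-·ˡ a [] [] = sym (ℚₚ.*-zeroʳ a)
B-·ˡ a (x ∷ u) (z ∷ w) = trans (cong ((a ℚ.* x) ℚ.* z ℚ.+_) (B-·ˡ a u w))
  (solve 4 (λ a x z b → (a :* x) :* z :+ a :* b := a :* (x :* z :+ b)) refl a x z (B u w))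

B-𝟘ˡ : ∀ {m} (w : V m) → B 𝟘 w ≡ 0ℚ
B-𝟘ˡ w = trans (cong (λ u → B u w) (sym (·-zeroˡ w))) (trans (B-·ˡ 0ℚ w w) (ℚₚ.*-zeroˡ (B w w)))

B-negˡ : ∀ {m} (u w : V m) → B (neg u) w ≡ ℚ.- B u w
B-negˡ u w = begin
  B (neg u) w               ≡⟨ cong (λ v → B v w) (neg≡-1· u) ⟩
  B ((ℚ.- 1ℚ) · u) w        ≡⟨ B-·ˡ (ℚ.- 1ℚ) u w ⟩
  (ℚ.- 1ℚ) ℚ.* B u w        ≡⟨ solve 1 (λ b → con (ℚ.- 1ℚ) :* b := :- b) refl (B u w) ⟩
  ℚ.- B u w                 ∎

B-⊖ˡ : ∀ {m} (u v w : V m) → B (u ⊖ v) w ≡ B u w ℚ.- B v w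
B-⊖ˡ u v w = trans (B-⊕ˡ u (neg v) w) (cong (B u w ℚ.+_) (B-negˡ v w))

B-⊕ʳ : ∀ {m} (u v w : V m) → B w (u ⊕ v) ≡ B w u ℚ.+ B w v
B-⊕ʳ u v w = trans (B-comm w (u ⊕ v)) (trans (B-⊕ˡ u v w) (cong₂ ℚ._+_ (B-comm u w) (B-comm v w)))

B-negʳ : ∀ {m} (u w : V m) → B w (neg u) ≡ ℚ.- B w u
B-negʳ u w = trans (B-comm w (neg u)) (trans (B-negˡ u w) (cong ℚ.-_ (B-comm u w)))

B-⊖ʳ : ∀ {m} (u v w : V m) → B w (u ⊖ v) ≡ B w u ℚ.- B w v
B-⊖ʳ u v w = trans (B-⊕ʳ u (neg v) w) (cong (B w u ℚ.+_) (B-negʳ v w))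

B-nonneg : ∀ {m} (v : V m) → 0ℚ ℚ.≤ B v v
B-nonneg [] = ℚₚ.≤-refl
B-nonneg (x ∷ v) = ℚₚ.+-mono-≤ (0≤x*x x) (B-nonneg v)

B[v,v]≡0⇒v≡𝟘 : ∀ {m} (v : V m) → B v v ≡ 0ℚ → v ≡ 𝟘
B[v,v]≡0⇒v≡𝟘 [] _ = refl
B[v,v]≡0⇒v≡𝟘 (x ∷ v) eq with x≡0⊎0<x*x x
... | inj₂ 0<x*x = ⊥-elim (ℚₚ.<-irrefl refl (subst (0ℚ ℚ.<_) eq (ℚₚ.+-mono-<-≤ 0<x*x (B-nonneg v))))
... | inj₁ refl = cong (0ℚ ∷_) (B[v,v]≡0⇒v≡𝟘 v (trans (sym (ℚₚ.+-identityˡ (B v v))) eq))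

Orthogonal : ∀ {n m} → (Fin n → V m) → Set
Orthogonal R = ∀ i j → i ≢ j → B (R i) (R j) ≡ 0ℚ

sum-zero : ∀ {n} (f : Fin n → ℚ) → (∀ i → f i ≡ 0ℚ) → sum f ≡ 0ℚ
sum-zero {n} f f≡0 = trans (sum-cong-≗ f≡0) (sum-replicate-zero n)

sum-single : ∀ {n} (j : Fin n) (f : Fin n → ℚ) → (∀ i → i ≢ j → f i ≡ 0ℚ) → sum f ≡ f j
sum-single {suc n} j f f≡0 = begin
  sum f                                   ≡⟨ sum-remove {i = j} f ⟩
  f j ℚ.+ sum (f ∘ punchIn j)             ≡⟨ cong (f j ℚ.+_) (sum-zero _ λ k → f≡0 _ (Finₚ.punchInᵢ≢i j k)) ⟩
  f j ℚ.+ 0ℚ                              ≡⟨ ℚₚ.+-identityʳ (f j) ⟩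
  f j                                     ∎

δ : ∀ {n} → Fin n → ℚ → Fin n → ℚ
δ zero    a zero    = a
δ zero    a (suc i) = 0ℚ
δ (suc j) a zero    = 0ℚ
δ (suc j) a (suc i) = δ j a i

δ-same : ∀ {n} (j : Fin n) a → δ j a j ≡ a
δ-same zero    a = refl
δ-same (suc j) a = δ-same j a

δ-other : ∀ {n} (j i : Fin n) a → i ≢ j → δ j a i ≡ 0ℚ
δ-other zero    zero    a i≢j = ⊥-elim (i≢j refl)
δ-other zero    (suc i) a i≢j = refl
δ-other (suc j) zero    a i≢j = refl
δ-other (suc j) (suc i) a i≢j = δ-other j i a (i≢j ∘ cong suc)

lincomb-cong : ∀ {n m} {R R' : Fin n → V m} {c c' : Fin n → ℚ} →
               (∀ i → R i ≡ R' i) → (∀ i → c i ≡ c' i) → lincomb R c ≡ lincomb R' c'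
lincomb-cong {zero}  R≗R' c≗c' = refl
lincomb-cong {suc n} R≗R' c≗c' =
  cong₂ _⊕_ (cong₂ _·_ (c≗c' zero) (R≗R' zero)) (lincomb-cong (R≗R' ∘ suc) (c≗c' ∘ suc))

lincomb-congʳ : ∀ {n m} (R : Fin n → V m) {c c' : Fin n → ℚ} → (∀ i → c i ≡ c' i) → lincomb R c ≡ lincomb R c'
lincomb-congʳ R = lincomb-cong λ _ → refl

lincomb-+ : ∀ {n m} (R : Fin n → V m) (c d : Fin n → ℚ) →
            lincomb R (λ i → c i ℚ.+ d i) ≡ lincomb R c ⊕ lincomb R d
lincomb-+ {zero}  R c d = sym (⊕-identityʳ 𝟘)
lincomb-+ {suc n} R c d = trans
  (cong₂ _⊕_ (·-distribʳ-+ (c zero) (d zero) (R zero)) (lincomb-+ (R ∘ suc) (c ∘ suc) (d ∘ suc)))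
  (⊕-interchange _ _ _ _)

lincomb-* : ∀ {n m} (R : Fin n → V m) a (c : Fin n → ℚ) → lincomb R (λ i → a ℚ.* c i) ≡ a · lincomb R c
lincomb-* {zero}  R a c = sym (·-zeroʳ a)
lincomb-* {suc n} R a c = trans
  (cong₂ _⊕_ (sym (·-assoc a (c zero) (R zero))) (lincomb-* (R ∘ suc) a (c ∘ suc)))
  (sym (·-distribˡ-⊕ a _ _))

lincomb-zero : ∀ {n m} (R : Fin n → V m) {c : Fin n → ℚ} → (∀ i → c i ≡ 0ℚ) → lincomb R c ≡ 𝟘
lincomb-zero {zero}  R c≡0 = refl
lincomb-zero {suc n} R c≡0 = trans
  (cong₂ _⊕_ (trans (cong (_· R zero) (c≡0 zero)) (·-zeroˡ (R zero))) (lincomb-zero (R ∘ suc) (c≡0 ∘ suc)))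
  (⊕-identityʳ 𝟘)

lincomb-δ : ∀ {n m} (R : Fin n → V m) (j : Fin n) a → lincomb R (δ j a) ≡ a · R j
lincomb-δ {suc n} R zero a = trans (cong (a · R zero ⊕_) (lincomb-zero (R ∘ suc) λ _ → refl)) (⊕-identityʳ _)
lincomb-δ {suc n} R (suc j) a =
  trans (cong₂ _⊕_ (·-zeroˡ (R zero)) (lincomb-δ (R ∘ suc) j a)) (⊕-identityˡ _)

lincomb-neg : ∀ {n m} (R : Fin n → V m) (c : Fin n → ℚ) → neg (lincomb R c) ≡ lincomb R (λ i → ℚ.- c i)
lincomb-neg R c = begin
  neg (lincomb R c)
    ≡⟨ neg≡-1· _ ⟩
  (ℚ.- 1ℚ) · lincomb R c
    ≡⟨ sym (lincomb-* R (ℚ.- 1ℚ) c) ⟩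
  lincomb R (λ i → (ℚ.- 1ℚ) ℚ.* c i)
    ≡⟨ lincomb-congʳ R (λ i → solve 1 (λ x → con (ℚ.- 1ℚ) :* x := :- x) refl (c i)) ⟩
  lincomb R (λ i → ℚ.- c i) ∎

lincomb-⊖ : ∀ {n m} (R : Fin n → V m) (c d : Fin n → ℚ) →
            lincomb R c ⊖ lincomb R d ≡ lincomb R (λ i → c i ℚ.- d i)
lincomb-⊖ R c d = trans (cong (lincomb R c ⊕_) (lincomb-neg R d)) (sym (lincomb-+ R c (λ i → ℚ.- d i)))

lincomb-⊕ᶠ : ∀ {n m} (f g : Fin n → V m) (d : Fin n → ℚ) →
             lincomb (λ j → f j ⊕ g j) d ≡ lincomb f d ⊕ lincomb g d
lincomb-⊕ᶠ {zero}  f g d = sym (⊕-identityʳ 𝟘)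
lincomb-⊕ᶠ {suc n} f g d = trans
  (cong₂ _⊕_ (·-distribˡ-⊕ (d zero) (f zero) (g zero)) (lincomb-⊕ᶠ (f ∘ suc) (g ∘ suc) (d ∘ suc)))
  (⊕-interchange _ _ _ _)

lincomb-·ᶠ : ∀ {n m} (r : Fin n → ℚ) (v : V m) (d : Fin n → ℚ) →
             lincomb (λ j → r j · v) d ≡ sum (λ j → d j ℚ.* r j) · v
lincomb-·ᶠ {zero}  r v d = sym (·-zeroˡ v)
lincomb-·ᶠ {suc n} r v d = trans
  (cong₂ _⊕_ (·-assoc (d zero) (r zero) v) (lincomb-·ᶠ (r ∘ suc) v (d ∘ suc)))
  (sym (·-distribʳ-+ (d zero ℚ.* r zero) _ v))

lincomb-∷ : ∀ {n m} (w : Fin n → V (suc m)) (c : Fin n → ℚ) →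
            lincomb w c ≡ sum (λ k → c k ℚ.* Vec.head (w k)) ∷ lincomb (Vec.tail ∘ w) c
lincomb-∷ {zero}  w c = refl
lincomb-∷ {suc n} w c with w zero
... | x ∷ _ = cong (_ ⊕_) (lincomb-∷ (w ∘ suc) (c ∘ suc))

lincomb-punchIn : ∀ {n m} (w : Fin (suc n) → V m) (c : Fin (suc n) → ℚ) (k : Fin (suc n)) →
                  lincomb w c ≡ c k · w k ⊕ lincomb (w ∘ punchIn k) (c ∘ punchIn k)
lincomb-punchIn w c zero = refl
lincomb-punchIn {suc n} w c (suc k) = begin
  c zero · w zero ⊕ lincomb (w ∘ suc) (c ∘ suc)
    ≡⟨ cong (c zero · w zero ⊕_) (lincomb-punchIn (w ∘ suc) (c ∘ suc) k) ⟩
  c zero · w zero ⊕ (c (suc k) · w (suc k) ⊕ rest)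
    ≡⟨ sym (⊕-assoc _ _ rest) ⟩
  (c zero · w zero ⊕ c (suc k) · w (suc k)) ⊕ rest
    ≡⟨ cong (_⊕ rest) (⊕-comm _ _) ⟩
  (c (suc k) · w (suc k) ⊕ c zero · w zero) ⊕ rest
    ≡⟨ ⊕-assoc _ _ rest ⟩
  c (suc k) · w (suc k) ⊕ (c zero · w zero ⊕ rest) ∎
  where rest = lincomb (w ∘ suc ∘ punchIn k) (c ∘ suc ∘ punchIn k)

B-lincombˡ : ∀ {n m} (R : Fin n → V m) (c : Fin n → ℚ) (v : V m) →
             B (lincomb R c) v ≡ sum (λ i → c i ℚ.* B (R i) v)
B-lincombˡ {zero}  R c v = B-𝟘ˡ v
B-lincombˡ {suc n} R c v = trans (B-⊕ˡ (c zero · R zero) _ v)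
  (cong₂ ℚ._+_ (B-·ˡ (c zero) (R zero) v) (B-lincombˡ (R ∘ suc) (c ∘ suc) v))

lincomb-∘ : ∀ {k n m} (R : Fin n → V m) (f : Fin k → Fin n) (x : Fin k → ℚ) →
            lincomb (R ∘ f) x ≡ lincomb R (λ i → sum (λ l → δ (f l) (x l) i))
lincomb-∘ {zero}  R f x = sym (lincomb-zero R λ _ → refl)
lincomb-∘ {suc k} R f x = trans
  (cong₂ _⊕_ (sym (lincomb-δ R (f zero) (x zero))) (lincomb-∘ R (f ∘ suc) (x ∘ suc)))
  (sym (lincomb-+ R _ _))

≗-lookup⇒≡ : ∀ {m} (u v : V m) → (∀ z → lookup u z ≡ lookup v z) → u ≡ v
≗-lookup⇒≡ u v u≗v = trans (sym (Vecₚ.tabulate∘lookup u)) (trans (Vecₚ.tabulate-cong u≗v) (Vecₚ.tabulate∘lookup v))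

lookup-e : ∀ {m} (k l : Fin m) → lookup (e k) l ≡ δ k 1ℚ l
lookup-e zero    zero    = refl
lookup-e zero    (suc l) = Vecₚ.lookup-replicate l 0ℚ
lookup-e (suc k) zero    = refl
lookup-e (suc k) (suc l) = lookup-e k l

lookup-lincomb : ∀ {n m} (F : Fin n → V m) (c : Fin n → ℚ) z →
                 lookup (lincomb F c) z ≡ sum (λ i → c i ℚ.* lookup (F i) z)
lookup-lincomb {zero}  F c z = Vecₚ.lookup-replicate z 0ℚ
lookup-lincomb {suc n} F c z = trans (Vecₚ.lookup-zipWith ℚ._+_ z (c zero · F zero) _)
  (cong₂ ℚ._+_ (Vecₚ.lookup-map z (c zero ℚ.*_) (F zero)) (lookup-lincomb (F ∘ suc) (c ∘ suc) z))

lookup-lincomb-e : ∀ {m} (c : Fin m → ℚ) z → lookup (lincomb e c) z ≡ c z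
lookup-lincomb-e c z = begin
  lookup (lincomb e c) z
    ≡⟨ lookup-lincomb e c z ⟩
  sum (λ i → c i ℚ.* lookup (e i) z)
    ≡⟨ sum-single z _ (λ i i≢z → trans (cong (c i ℚ.*_) (trans (lookup-e i z) (δ-other i z 1ℚ (i≢z ∘ sym)))) (ℚₚ.*-zeroʳ (c i))) ⟩
  c z ℚ.* lookup (e z) z
    ≡⟨ cong (c z ℚ.*_) (trans (lookup-e z z) (δ-same z 1ℚ)) ⟩
  c z ℚ.* 1ℚ
    ≡⟨ ℚₚ.*-identityʳ (c z) ⟩
  c z ∎

B-as-sum : ∀ {m} (x y : V m) → B x y ≡ sum (λ k → lookup x k ℚ.* lookup y k)
B-as-sum [] [] = refl
B-as-sum (a ∷ x) (b ∷ y) = cong (a ℚ.* b ℚ.+_) (B-as-sum x y)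

B-e : ∀ {m} (i : Fin m) (v : V m) → B (e i) v ≡ lookup v i
B-e i v = begin
  B (e i) v
    ≡⟨ B-as-sum (e i) v ⟩
  sum (λ k → lookup (e i) k ℚ.* lookup v k)
    ≡⟨ sum-single i _ (λ k k≢i → trans (cong (ℚ._* lookup v k) (trans (lookup-e i k) (δ-other i k 1ℚ k≢i))) (ℚₚ.*-zeroˡ (lookup v k))) ⟩
  lookup (e i) i ℚ.* lookup v i
    ≡⟨ cong (ℚ._* lookup v i) (trans (lookup-e i i) (δ-same i 1ℚ)) ⟩
  1ℚ ℚ.* lookup v i
    ≡⟨ ℚₚ.*-identityˡ (lookup v i) ⟩
  lookup v i ∎

lin : ∀ {k m} → (Fin k → V m) → V k → V m
lin F y = lincomb F (lookup y)

lin-⊕ : ∀ {k m} (F : Fin k → V m) x y → lin F (x ⊕ y) ≡ lin F x ⊕ lin F y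
lin-⊕ F x y = trans (lincomb-congʳ F (λ i → Vecₚ.lookup-zipWith ℚ._+_ i x y)) (lincomb-+ F (lookup x) (lookup y))

lin-· : ∀ {k m} (F : Fin k → V m) a x → lin F (a · x) ≡ a · lin F x
lin-· F a x = trans (lincomb-congʳ F (λ i → Vecₚ.lookup-map i (a ℚ.*_) x)) (lincomb-* F a (lookup x))

lin-neg : ∀ {k m} (F : Fin k → V m) x → lin F (neg x) ≡ neg (lin F x)
lin-neg F x = trans (lincomb-congʳ F (λ i → Vecₚ.lookup-map i ℚ.-_ x)) (sym (lincomb-neg F (lookup x)))

lin-⊖ : ∀ {k m} (F : Fin k → V m) x y → lin F (x ⊖ y) ≡ lin F x ⊖ lin F y
lin-⊖ F x y = trans (lin-⊕ F x (neg y)) (cong (lin F x ⊕_) (lin-neg F y))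

lin-𝟘 : ∀ {k m} (F : Fin k → V m) → lin F 𝟘 ≡ 𝟘
lin-𝟘 F = lincomb-zero F (λ i → Vecₚ.lookup-replicate i 0ℚ)

lin-e : ∀ {k m} (F : Fin k → V m) i → lin F (e i) ≡ F i
lin-e F i = trans (lincomb-congʳ F (lookup-e i)) (trans (lincomb-δ F i 1ℚ) (·-identityˡ (F i)))

lin-lincomb : ∀ {n k m} (F : Fin k → V m) (w : Fin n → V k) (c : Fin n → ℚ) →
              lin F (lincomb w c) ≡ lincomb (lin F ∘ w) c
lin-lincomb {zero}  F w c = lin-𝟘 F
lin-lincomb {suc n} F w c = trans (lin-⊕ F (c zero · w zero) _)
  (cong₂ _⊕_ (lin-· F (c zero) (w zero)) (lin-lincomb F (w ∘ suc) (c ∘ suc)))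

-- The coefficient of v along R i when the R i are orthogonal of norm 2.
coord : ∀ {n m} → (Fin n → V m) → V m → Fin n → ℚ
coord R v i = ½ ℚ.* B v (R i)

module OrthogonalFrame {n m} (R : Fin n → V m) (orth : Orthogonal R) (norm : ∀ i → B (R i) (R i) ≡ 2ℚ) where

  B-lincomb-frame : (c : Fin n → ℚ) (j : Fin n) → B (lincomb R c) (R j) ≡ c j ℚ.* 2ℚ
  B-lincomb-frame c j = begin
    B (lincomb R c) (R j)
      ≡⟨ B-lincombˡ R c (R j) ⟩
    sum (λ i → c i ℚ.* B (R i) (R j))
      ≡⟨ sum-single j _ (λ i i≢j → trans (cong (c i ℚ.*_) (orth i j i≢j)) (ℚₚ.*-zeroʳ (c i))) ⟩
    c j ℚ.* B (R j) (R j)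
      ≡⟨ cong (c j ℚ.*_) (norm j) ⟩
    c j ℚ.* 2ℚ ∎

  coefficient : ∀ (c : Fin n → ℚ) v → v ≡ lincomb R c → ∀ j → c j ≡ coord R v j
  coefficient c v refl j = trans (solve 1 (λ x → x := con ½ :* (x :* (con 1ℚ :+ con 1ℚ))) refl (c j))
                                 (cong (½ ℚ.*_) (sym (B-lincomb-frame c j)))

  B-frame : ∀ x y → B (lin R x) (lin R y) ≡ 2ℚ ℚ.* B x y
  B-frame x y = begin
    B (lin R x) (lin R y)
      ≡⟨ B-lincombˡ R (lookup x) (lin R y) ⟩
    sum (λ k → lookup x k ℚ.* B (R k) (lin R y))
      ≡⟨ sum-cong-≗ (λ k → cong (lookup x k ℚ.*_) (trans (B-comm (R k) (lin R y)) (B-lincomb-frame (lookup y) k))) ⟩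
    sum (λ k → lookup x k ℚ.* (lookup y k ℚ.* 2ℚ))
      ≡⟨ sum-cong-≗ (λ k → solve 3 (λ a b c → a :* (b :* c) := c :* (a :* b)) refl (lookup x k) (lookup y k) 2ℚ) ⟩
    sum (λ k → 2ℚ ℚ.* (lookup x k ℚ.* lookup y k))
      ≡⟨ sym (*-distribˡ-sum 2ℚ (λ k → lookup x k ℚ.* lookup y k)) ⟩
    2ℚ ℚ.* sum (λ k → lookup x k ℚ.* lookup y k)
      ≡⟨ cong (2ℚ ℚ.*_) (sym (B-as-sum x y)) ⟩
    2ℚ ℚ.* B x y ∎

  parseval : ∀ v → v ≡ lincomb R (coord R v) → sum (λ i → B v (R i) ℚ.* B v (R i)) ≡ 2ℚ ℚ.* B v v
  parseval v v≡ = begin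
    sum (λ i → b i ℚ.* b i)
      ≡⟨ sum-cong-≗ (λ i → solve 1 (λ x → x :* x := (con 1ℚ :+ con 1ℚ) :* (con ½ :* x :* x)) refl (b i)) ⟩
    sum (λ i → 2ℚ ℚ.* (½ ℚ.* b i ℚ.* b i))
      ≡⟨ sym (*-distribˡ-sum 2ℚ (λ i → ½ ℚ.* b i ℚ.* b i)) ⟩
    2ℚ ℚ.* sum (λ i → ½ ℚ.* b i ℚ.* b i)
      ≡⟨ cong (2ℚ ℚ.*_) (sum-cong-≗ (λ i → cong (½ ℚ.* b i ℚ.*_) (B-comm v (R i)))) ⟩
    2ℚ ℚ.* sum (λ i → coord R v i ℚ.* B (R i) v)
      ≡⟨ cong (2ℚ ℚ.*_) (sym (B-lincombˡ R (coord R v) v)) ⟩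
    2ℚ ℚ.* B (lincomb R (coord R v)) v
      ≡⟨ cong (λ u → 2ℚ ℚ.* B u v) (sym v≡) ⟩
    2ℚ ℚ.* B v v ∎
    where
    b : Fin n → ℚ
    b i = B v (R i)

head-⊖-· : ∀ {m} (u v : V (suc m)) a → Vec.head (u ⊖ a · v) ≡ Vec.head u ℚ.- a ℚ.* Vec.head v
head-⊖-· (x ∷ u) (y ∷ v) a = refl

Dependent : ∀ {N m} → (Fin N → V m) → Set
Dependent {N} w = Σ (Fin N → ℚ) λ c → (Σ (Fin N) λ k → c k ≢ 0ℚ) × lincomb w c ≡ 𝟘

nonzero? : ∀ {N} (f : Fin N → ℚ) → (∀ k → f k ≡ 0ℚ) ⊎ Σ (Fin N) λ k → f k ≢ 0ℚ
nonzero? {zero}  f = inj₁ λ ()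
nonzero? {suc N} f with f zero ℚₚ.≟ 0ℚ | nonzero? (f ∘ suc)
... | no f₀≢0 | _                = inj₂ (zero , f₀≢0)
... | yes _   | inj₂ (k , fₖ≢0)  = inj₂ (suc k , fₖ≢0)
... | yes f₀≡0 | inj₁ rest≡0     = inj₁ λ { zero → f₀≡0 ; (suc k) → rest≡0 k }

lincomb-zero-heads : ∀ {N m} (w : Fin N → V (suc m)) (c : Fin N → ℚ) → (∀ k → Vec.head (w k) ≡ 0ℚ) →
                     lincomb (Vec.tail ∘ w) c ≡ 𝟘 → lincomb w c ≡ 𝟘
lincomb-zero-heads w c heads≡0 tails≡𝟘 = trans (lincomb-∷ w c)
  (cong₂ _∷_ (sum-zero _ λ k → trans (cong (c k ℚ.*_) (heads≡0 k)) (ℚₚ.*-zeroʳ (c k))) tails≡𝟘)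

-- Gaussian elimination: subtracting multiples of the pivot w k clears the first coordinate of the other vectors.
module Pivot {N m} (w : Fin (suc N) → V (suc m)) (k : Fin (suc N)) (pivot≢0 : Vec.head (w k) ≢ 0ℚ) where

  instance _ = ℚ.≢-nonZero pivot≢0

  ratio : Fin N → ℚ
  ratio j = Vec.head (w (punchIn k j)) ℚ.* ℚ.1/ Vec.head (w k)

  reduced : Fin N → V (suc m)
  reduced j = w (punchIn k j) ⊖ ratio j · w k

  head-reduced : ∀ j → Vec.head (reduced j) ≡ 0ℚ
  head-reduced j = begin
    Vec.head (reduced j)
      ≡⟨ head-⊖-· (w (punchIn k j)) (w k) (ratio j) ⟩
    y ℚ.- y ℚ.* ℚ.1/ x ℚ.* x
      ≡⟨ solve 3 (λ y x' x → y :- y :* x' :* x := y :- y :* (x' :* x)) refl y (ℚ.1/ x) x ⟩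
    y ℚ.- y ℚ.* (ℚ.1/ x ℚ.* x)
      ≡⟨ cong (λ z → y ℚ.- y ℚ.* z) (ℚₚ.*-inverseˡ x) ⟩
    y ℚ.- y ℚ.* 1ℚ
      ≡⟨ solve 1 (λ y → y :- y :* con 1ℚ := con 0ℚ) refl y ⟩
    0ℚ ∎
    where
    x = Vec.head (w k)
    y = Vec.head (w (punchIn k j))

  w≡reduced+ratio·pivot : ∀ j → w (punchIn k j) ≡ reduced j ⊕ ratio j · w k
  w≡reduced+ratio·pivot j = sym (begin
    (w (punchIn k j) ⊕ neg (ratio j · w k)) ⊕ ratio j · w k
      ≡⟨ ⊕-assoc _ _ _ ⟩
    w (punchIn k j) ⊕ (neg (ratio j · w k) ⊕ ratio j · w k)
      ≡⟨ cong (w (punchIn k j) ⊕_) (trans (⊕-comm _ _) (⊖-self (ratio j · w k))) ⟩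
    w (punchIn k j) ⊕ 𝟘
      ≡⟨ ⊕-identityʳ _ ⟩
    w (punchIn k j) ∎)

  lift : Dependent (Vec.tail ∘ reduced) → Dependent w
  lift (d , (j , dⱼ≢0) , tails≡𝟘) = c , (punchIn k j , dⱼ≢0 ∘ trans (sym (insertAt-punchIn d k a j))) , (begin
    lincomb w c
      ≡⟨ lincomb-punchIn w c k ⟩
    c k · w k ⊕ lincomb (w ∘ punchIn k) (c ∘ punchIn k)
      ≡⟨ cong₂ (λ x y → x · w k ⊕ y) (insertAt-lookup d k a) (lincomb-cong w≡reduced+ratio·pivot (insertAt-punchIn d k a)) ⟩
    a · w k ⊕ lincomb (λ j → reduced j ⊕ ratio j · w k) d
      ≡⟨ cong (a · w k ⊕_) (lincomb-⊕ᶠ reduced (λ j → ratio j · w k) d) ⟩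
    a · w k ⊕ (lincomb reduced d ⊕ lincomb (λ j → ratio j · w k) d)
      ≡⟨ cong (a · w k ⊕_) (cong₂ _⊕_ (lincomb-zero-heads reduced d head-reduced tails≡𝟘) (lincomb-·ᶠ ratio (w k) d)) ⟩
    a · w k ⊕ (𝟘 ⊕ Σdr · w k)
      ≡⟨ cong (a · w k ⊕_) (⊕-identityˡ _) ⟩
    a · w k ⊕ Σdr · w k
      ≡⟨ sym (·-distribʳ-+ a Σdr (w k)) ⟩
    (a ℚ.+ Σdr) · w k
      ≡⟨ cong (_· w k) (ℚₚ.+-inverseˡ Σdr) ⟩
    0ℚ · w k
      ≡⟨ ·-zeroˡ (w k) ⟩
    𝟘 ∎)
    where
    Σdr = sum (λ j → d j ℚ.* ratio j)
    a = ℚ.- Σdr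
    c = insertAt d k a

dependent : ∀ m N → m ℕ.< N → (w : Fin N → V m) → Dependent w
dependent zero (suc N) _ w = (λ _ → 1ℚ) , (zero , λ ()) , V₀-trivial (lincomb w (λ _ → 1ℚ))
  where
  V₀-trivial : (u : V 0) → u ≡ 𝟘
  V₀-trivial [] = refl
dependent (suc m) (suc N) (s≤s m<N) w with nonzero? (Vec.head ∘ w)
... | inj₁ heads≡0 =
  let (c , c≢0 , tails≡𝟘) = dependent m (suc N) (ℕₚ.m≤n⇒m≤1+n m<N) (Vec.tail ∘ w)
  in c , c≢0 , lincomb-zero-heads w c heads≡0 tails≡𝟘
... | inj₂ (k , pivot≢0) = lift (dependent m N m<N (Vec.tail ∘ reduced))
  where open Pivot w k pivot≢0

·-cancel : ∀ {m} a (v : V m) → a · v ≡ 𝟘 → a ≢ 0ℚ → v ≡ 𝟘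
·-cancel a v av≡𝟘 a≢0 = begin
  v                           ≡⟨ sym (·-identityˡ v) ⟩
  1ℚ · v                      ≡⟨ cong (_· v) (sym (ℚₚ.*-inverseˡ a)) ⟩
  (ℚ.1/ a ℚ.* a) · v          ≡⟨ sym (·-assoc (ℚ.1/ a) a v) ⟩
  ℚ.1/ a · (a · v)            ≡⟨ cong (ℚ.1/ a ·_) av≡𝟘 ⟩
  ℚ.1/ a · 𝟘                  ≡⟨ ·-zeroʳ (ℚ.1/ a) ⟩
  𝟘                           ∎
  where instance _ = ℚ.≢-nonZero a≢0

orthogonal-coefficients-zero : ∀ {n m} (u : Fin n → V m) → Orthogonal u → (∀ i → B (u i) (u i) ≢ 0ℚ) →
  ∀ (c : Fin n → ℚ) w → (∀ j → B w (u j) ≡ 0ℚ) → lincomb u c ≡ w → ∀ j → c j ≡ 0ℚ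
orthogonal-coefficients-zero u orth nondeg c w w⊥u eq j = *-cancelʳ-≢0 (c j) _ cⱼuⱼ²≡0 (nondeg j)
  where
  cⱼuⱼ²≡0 : c j ℚ.* B (u j) (u j) ≡ 0ℚ
  cⱼuⱼ²≡0 = begin
    c j ℚ.* B (u j) (u j)
      ≡⟨ sym (sum-single j _ (λ i i≢j → trans (cong (c i ℚ.*_) (orth i j i≢j)) (ℚₚ.*-zeroʳ (c i)))) ⟩
    sum (λ i → c i ℚ.* B (u i) (u j))
      ≡⟨ sym (B-lincombˡ u c (u j)) ⟩
    B (lincomb u c) (u j)
      ≡⟨ cong (λ x → B x (u j)) eq ⟩
    B w (u j)
      ≡⟨ w⊥u j ⟩
    0ℚ ∎

orthogonal-complement-trivial : ∀ {m} (u : Fin m → V m) → Orthogonal u → (∀ i → B (u i) (u i) ≢ 0ℚ) →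
  ∀ v → (∀ i → B v (u i) ≡ 0ℚ) → v ≡ 𝟘
orthogonal-complement-trivial {m} u orth nondeg v v⊥u = ·-cancel (c zero) v c₀v≡𝟘 c₀≢0
  where
  dep = dependent m (suc m) (ℕₚ.n<1+n m) λ { zero → v ; (suc i) → u i }
  c = proj₁ dep
  c₀v+Σcu≡𝟘 : c zero · v ⊕ lincomb u (c ∘ suc) ≡ 𝟘
  c₀v+Σcu≡𝟘 = proj₂ (proj₂ dep)
  Σcu≡-c₀v : lincomb u (c ∘ suc) ≡ neg (c zero · v)
  Σcu≡-c₀v = ⊕≡𝟘⇒≡neg _ _ (trans (⊕-comm _ _) c₀v+Σcu≡𝟘)
  -c₀v⊥u : ∀ j → B (neg (c zero · v)) (u j) ≡ 0ℚ
  -c₀v⊥u j = begin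
    B (neg (c zero · v)) (u j)     ≡⟨ B-negˡ (c zero · v) (u j) ⟩
    ℚ.- B (c zero · v) (u j)       ≡⟨ cong ℚ.-_ (B-·ˡ (c zero) v (u j)) ⟩
    ℚ.- (c zero ℚ.* B v (u j))     ≡⟨ cong (λ x → ℚ.- (c zero ℚ.* x)) (v⊥u j) ⟩
    ℚ.- (c zero ℚ.* 0ℚ)            ≡⟨ cong ℚ.-_ (ℚₚ.*-zeroʳ (c zero)) ⟩
    0ℚ                             ∎
  cₛ≡0 : ∀ j → c (suc j) ≡ 0ℚ
  cₛ≡0 = orthogonal-coefficients-zero u orth nondeg (c ∘ suc) _ -c₀v⊥u Σcu≡-c₀v
  c₀v≡𝟘 : c zero · v ≡ 𝟘
  c₀v≡𝟘 = trans (sym (⊕-identityʳ _)) (trans (cong (c zero · v ⊕_) (sym (lincomb-zero u cₛ≡0))) c₀v+Σcu≡𝟘)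
  c₀≢0 : c zero ≢ 0ℚ
  c₀≢0 with proj₁ (proj₂ dep)
  ... | zero , c₀≢0    = c₀≢0
  ... | suc j , cⱼ≢0   = ⊥-elim (cⱼ≢0 (cₛ≡0 j))

expansion : ∀ {m} (R : Fin m → V m) → Orthogonal R → (∀ i → B (R i) (R i) ≡ 2ℚ) →
            ∀ v → v ≡ lincomb R (coord R v)
expansion R orth norm v = ⊖≡𝟘⇒≡ v _ (orthogonal-complement-trivial R orth (≡2⇒≢0 ∘ norm) _ residual⊥R)
  where
  open OrthogonalFrame R orth norm
  residual⊥R : ∀ j → B (v ⊖ lincomb R (coord R v)) (R j) ≡ 0ℚ
  residual⊥R j = begin
    B (v ⊖ lincomb R (coord R v)) (R j)
      ≡⟨ B-⊖ˡ v _ (R j) ⟩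
    B v (R j) ℚ.- B (lincomb R (coord R v)) (R j)
      ≡⟨ cong (λ x → B v (R j) ℚ.- x) (B-lincomb-frame (coord R v) j) ⟩
    B v (R j) ℚ.- ½ ℚ.* B v (R j) ℚ.* 2ℚ
      ≡⟨ solve 1 (λ x → x :- con ½ :* x :* (con 1ℚ :+ con 1ℚ) := con 0ℚ) refl (B v (R j)) ⟩
    0ℚ ∎

⊆∧∣∣≡⇒≡ : ∀ {n} {p q : Subset n} → p ⊆ q → ∣ p ∣ ≡ ∣ q ∣ → p ≡ q
⊆∧∣∣≡⇒≡ {p = []}          {[]}          _   _  = refl
⊆∧∣∣≡⇒≡ {p = inside ∷ p}  {inside ∷ q}  p⊆q eq = cong (inside ∷_) (⊆∧∣∣≡⇒≡ (Subsetₚ.drop-∷-⊆ p⊆q) (ℕₚ.suc-injective eq))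
⊆∧∣∣≡⇒≡ {p = outside ∷ p} {outside ∷ q} p⊆q eq = cong (outside ∷_) (⊆∧∣∣≡⇒≡ (Subsetₚ.drop-∷-⊆ p⊆q) eq)
⊆∧∣∣≡⇒≡ {p = inside ∷ p}  {outside ∷ q} p⊆q _  with p⊆q Vec.here
... | ()
⊆∧∣∣≡⇒≡ {p = outside ∷ p} {inside ∷ q}  p⊆q eq =
  ⊥-elim (ℕₚ.<-irrefl eq (s≤s (Subsetₚ.p⊆q⇒∣p∣≤∣q∣ (Subsetₚ.drop-∷-⊆ p⊆q))))

enum : ∀ {n} (p : Subset n) → Fin ∣ p ∣ → Fin n
enum (inside ∷ p)  zero    = zero
enum (inside ∷ p)  (suc k) = suc (enum p k)
enum (outside ∷ p) k       = suc (enum p k)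

enum-∈ : ∀ {n} (p : Subset n) k → enum p k ∈ p
enum-∈ (inside ∷ p)  zero    = Vec.here
enum-∈ (inside ∷ p)  (suc k) = Vec.there (enum-∈ p k)
enum-∈ (outside ∷ p) k       = Vec.there (enum-∈ p k)

enum-injective : ∀ {n} (p : Subset n) k l → enum p k ≡ enum p l → k ≡ l
enum-injective (inside ∷ p)  zero    zero    _  = refl
enum-injective (inside ∷ p)  (suc k) (suc l) eq = cong suc (enum-injective p k l (Finₚ.suc-injective eq))
enum-injective (outside ∷ p) k       l       eq = enum-injective p k l (Finₚ.suc-injective eq)

enum-surjective : ∀ {n} (p : Subset n) i → i ∈ p → Σ (Fin ∣ p ∣) λ k → enum p k ≡ i
enum-surjective (inside ∷ p)  zero    _               = zero , refl
enum-surjective (inside ∷ p)  (suc i) (Vec.there i∈p) with enum-surjective p i i∈p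
... | k , refl = suc k , refl
enum-surjective (outside ∷ p) (suc i) (Vec.there i∈p) with enum-surjective p i i∈p
... | k , refl = k , refl

record Enumeration {n} (p : Subset n) (k : ℕ) : Set where
  field
    at            : Fin k → Fin n
    at-∈          : ∀ l → at l ∈ p
    at-injective  : ∀ l l' → at l ≡ at l' → l ≡ l'
    at-surjective : ∀ i → i ∈ p → Σ (Fin k) λ l → at l ≡ i

enumeration : ∀ {n k} (p : Subset n) → ∣ p ∣ ≡ k → Enumeration p k
enumeration p ∣p∣≡k = record
  { at            = enum p ∘ Fin.cast (sym ∣p∣≡k)
  ; at-∈          = λ l → enum-∈ p _
  ; at-injective  = λ l l' eq → begin
      l                                ≡⟨ sym (Finₚ.cast-involutive ∣p∣≡k (sym ∣p∣≡k) l) ⟩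
      Fin.cast ∣p∣≡k (Fin.cast _ l)    ≡⟨ cong (Fin.cast ∣p∣≡k) (enum-injective p _ _ eq) ⟩
      Fin.cast ∣p∣≡k (Fin.cast _ l')   ≡⟨ Finₚ.cast-involutive ∣p∣≡k (sym ∣p∣≡k) l' ⟩
      l'                               ∎
  ; at-surjective = λ i i∈p → let (l , eq) = enum-surjective p i i∈p in
      Fin.cast ∣p∣≡k l , trans (cong (enum p) (Finₚ.cast-involutive (sym ∣p∣≡k) ∣p∣≡k l)) eq
  }

fromℕ : ℕ → ℚ
fromℕ zero    = 0ℚ
fromℕ (suc k) = 1ℚ ℚ.+ fromℕ k

fromℕ-nonneg : ∀ k → 0ℚ ℚ.≤ fromℕ k
fromℕ-nonneg zero    = ℚₚ.≤-refl
fromℕ-nonneg (suc k) = ℚₚ.+-mono-≤ (ℚₚ.<⇒≤ (ℚₚ.positive⁻¹ 1ℚ)) (fromℕ-nonneg k)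

fromℕ-suc≢0 : ∀ k → fromℕ (suc k) ≢ 0ℚ
fromℕ-suc≢0 k eq = ℚₚ.<-irrefl (sym eq) (ℚₚ.+-mono-<-≤ (ℚₚ.positive⁻¹ 1ℚ) (fromℕ-nonneg k))

fromℕ-injective : ∀ a b → fromℕ a ≡ fromℕ b → a ≡ b
fromℕ-injective zero    zero    _  = refl
fromℕ-injective zero    (suc b) eq = ⊥-elim (fromℕ-suc≢0 b (sym eq))
fromℕ-injective (suc a) zero    eq = ⊥-elim (fromℕ-suc≢0 a eq)
fromℕ-injective (suc a) (suc b) eq = cong suc (fromℕ-injective a b (+-cancelˡ 1ℚ _ _ eq))

sum-characteristic : ∀ {n} (p : Subset n) (t : Fin n → ℚ) →
                     (∀ i → i ∈ p → t i ≡ 1ℚ) → (∀ i → i ∉ p → t i ≡ 0ℚ) → sum t ≡ fromℕ ∣ p ∣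
sum-characteristic []            t _   _   = refl
sum-characteristic (inside ∷ p)  t t∈ t∉ = cong₂ ℚ._+_ (t∈ zero Vec.here)
  (sum-characteristic p (t ∘ suc) (λ i → t∈ (suc i) ∘ Vec.there) (λ i i∉p → t∉ (suc i) (i∉p ∘ Subsetₚ.drop-there)))
sum-characteristic (outside ∷ p) t t∈ t∉ = trans (cong₂ ℚ._+_ (t∉ zero λ ())
  (sum-characteristic p (t ∘ suc) (λ i → t∈ (suc i) ∘ Vec.there) (λ i i∉p → t∉ (suc i) (i∉p ∘ Subsetₚ.drop-there))))
  (ℚₚ.+-identityˡ _)

module _ {n m} (R : Fin n → V m) (p : Subset n) where

  indicator-∈ : ∀ {i} → i ∈ p → indicator R p i ≡ 1ℚ
  indicator-∈ {i} i∈p with lookup p i | Vecₚ.[]=⇒lookup i∈p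
  ... | inside | _ = refl

  indicator-∉ : ∀ {i} → i ∉ p → indicator R p i ≡ 0ℚ
  indicator-∉ {i} i∉p with lookup p i | Vecₚ.lookup⇒[]= i p
  ... | inside  | lookup≡inside = ⊥-elim (i∉p (lookup≡inside refl))
  ... | outside | _ = refl

-- The Hurwitz units

anySign? : {P : Sign → Set} → (∀ s → Dec (P s)) → Dec (∃ P)
anySign? P? with P? Sign.+ | P? Sign.-
... | yes p | _     = yes (Sign.+ , p)
... | no _  | yes p = yes (Sign.- , p)
... | no ¬p | no ¬q = no λ { (Sign.+ , p) → ¬p p ; (Sign.- , q) → ¬q q }

allSign? : {P : Sign → Set} → (∀ s → Dec (P s)) → Dec (∀ s → P s)
allSign? P? with P? Sign.+ | P? Sign.-
... | yes p | yes q = yes λ { Sign.+ → p ; Sign.- → q }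
... | no ¬p | _     = no λ f → ¬p (f Sign.+)
... | yes _ | no ¬q = no λ f → ¬q (f Sign.-)

_≟ᵥ_ : ∀ {m} (u v : V m) → Dec (u ≡ v)
_≟ᵥ_ = Vecₚ.≡-dec ℚₚ._≟_

DRootsOf : ∀ {k m} → (Fin k → V m) → VSet m
DRootsOf {k} ε v = Σ (Fin k) λ i → Σ (Fin k) λ j → i ≢ j ×
                   Σ Sign λ s → Σ Sign λ t → v ≡ (sgn s · ε i) ⊕ (sgn t · ε j)

half4 : Sign → Sign → Sign → Sign → V 4
half4 a b c d = (½ ℚ.* sgn a) ∷ (½ ℚ.* sgn b) ∷ (½ ℚ.* sgn c) ∷ (½ ℚ.* sgn d) ∷ []

half4-cong : ∀ {a a' b b' c c' d d'} → a ≡ a' → b ≡ b' → c ≡ c' → d ≡ d' → half4 a b c d ≡ half4 a' b' c' d'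
half4-cong refl refl refl refl = refl

-- The roots of D₄, scaled to norm 1.
Hurwitz : V 4 → Set
Hurwitz x = (Σ (Fin 4) λ k → Σ Sign λ s → x ≡ sgn s · e k)
          ⊎ (Σ Sign λ a → Σ Sign λ b → Σ Sign λ c → Σ Sign λ d → x ≡ half4 a b c d)

E4 : Fin 4 → V 4
E4 zero                   = ½  ∷ ½      ∷ 0ℚ ∷ 0ℚ     ∷ []
E4 (suc zero)             = ½  ∷ ℚ.- ½  ∷ 0ℚ ∷ 0ℚ     ∷ []
E4 (suc (suc zero))       = 0ℚ ∷ 0ℚ     ∷ ½  ∷ ½      ∷ []
E4 (suc (suc (suc zero))) = 0ℚ ∷ 0ℚ     ∷ ½  ∷ ℚ.- ½  ∷ []

-- The reflection in e k for the form 2B, which is what B becomes in the coordinates of four orthogonal roots.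
reflₑ : Fin 4 → V 4 → V 4
reflₑ k x = x ⊖ (2ℚ ℚ.* B (e k) x) · e k

Hurwitz? : ∀ x → Dec (Hurwitz x)
Hurwitz? x = (Finₚ.any? λ k → anySign? λ s → x ≟ᵥ (sgn s · e k))
  ⊎-dec (anySign? λ a → anySign? λ b → anySign? λ c → anySign? λ d → x ≟ᵥ half4 a b c d)

DRootsOfE4? : ∀ x → Dec (DRootsOf E4 x)
DRootsOfE4? x = Finₚ.any? λ i → Finₚ.any? λ j → ¬? (i Finₚ.≟ j) ×-dec
  anySign? λ s → anySign? λ t → x ≟ᵥ ((sgn s · E4 i) ⊕ (sgn t · E4 j))

E4-norm : ∀ i → 2ℚ ℚ.* B (E4 i) (E4 i) ≡ 1ℚ
E4-norm = toWitness {a? = Finₚ.all? λ i → 2ℚ ℚ.* B (E4 i) (E4 i) ℚₚ.≟ 1ℚ} _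

E4-orthogonal : Orthogonal E4
E4-orthogonal = toWitness {a? = Finₚ.all? λ i → Finₚ.all? λ j → ¬? (i Finₚ.≟ j) →-dec B (E4 i) (E4 j) ℚₚ.≟ 0ℚ} _

Hurwitz→DRootsOfE4 : ∀ {x} → Hurwitz x → DRootsOf E4 x
Hurwitz→DRootsOfE4 (inj₁ (k , s , refl)) =
  toWitness {a? = Finₚ.all? λ k → allSign? λ s → DRootsOfE4? (sgn s · e k)} _ k s
Hurwitz→DRootsOfE4 (inj₂ (a , b , c , d , refl)) =
  toWitness {a? = allSign? λ a → allSign? λ b → allSign? λ c → allSign? λ d → DRootsOfE4? (half4 a b c d)} _ a b c d

DRootsOfE4→Hurwitz : ∀ {x} → DRootsOf E4 x → Hurwitz x
DRootsOfE4→Hurwitz (i , j , i≢j , s , t , refl) =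
  toWitness {a? = Finₚ.all? λ i → Finₚ.all? λ j → ¬? (i Finₚ.≟ j) →-dec allSign? λ s → allSign? λ t →
                  Hurwitz? ((sgn s · E4 i) ⊕ (sgn t · E4 j))} _ i j i≢j s t

reflₑ-e : ∀ k → reflₑ k (e k) ≡ sgn Sign.- · e k
reflₑ-e = toWitness {a? = Finₚ.all? λ k → reflₑ k (e k) ≟ᵥ (sgn Sign.- · e k)} _

reflₑ-half4 : ∀ a b c d →
  reflₑ zero (half4 a b c d) ≡ half4 (opposite a) b c d ×
  reflₑ (suc zero) (half4 a b c d) ≡ half4 a (opposite b) c d ×
  reflₑ (suc (suc zero)) (half4 a b c d) ≡ half4 a b (opposite c) d ×
  reflₑ (suc (suc (suc zero))) (half4 a b c d) ≡ half4 a b c (opposite d)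
reflₑ-half4 = toWitness {a? = allSign? λ a → allSign? λ b → allSign? λ c → allSign? λ d →
  (reflₑ zero (half4 a b c d) ≟ᵥ half4 (opposite a) b c d) ×-dec
  (reflₑ (suc zero) (half4 a b c d) ≟ᵥ half4 a (opposite b) c d) ×-dec
  (reflₑ (suc (suc zero)) (half4 a b c d) ≟ᵥ half4 a b (opposite c) d) ×-dec
  (reflₑ (suc (suc (suc zero))) (half4 a b c d) ≟ᵥ half4 a b c (opposite d))} _

module HurwitzGeneration (P : V 4 → Set) (closed : ∀ k x → P x → P (reflₑ k x)) where

  keep-or-flip : ∀ (f : Sign → V 4) k → (∀ s → reflₑ k (f s) ≡ f (opposite s)) → ∀ s → P (f s) → ∀ s' → P (f s')
  keep-or-flip f k flip Sign.+ p Sign.+ = p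
  keep-or-flip f k flip Sign.- p Sign.- = p
  keep-or-flip f k flip Sign.+ p Sign.- = subst P (flip Sign.+) (closed k _ p)
  keep-or-flip f k flip Sign.- p Sign.+ = subst P (flip Sign.-) (closed k _ p)

  half4-reachable : ∀ a b c d → P (half4 a b c d) → ∀ a' b' c' d' → P (half4 a' b' c' d')
  half4-reachable a b c d p a' b' c' d' =
    keep-or-flip (half4 a' b' c') (suc (suc (suc zero))) (λ s → proj₂ (proj₂ (proj₂ (reflₑ-half4 a' b' c' s)))) d
    (keep-or-flip (λ s → half4 a' b' s d) (suc (suc zero)) (λ s → proj₁ (proj₂ (proj₂ (reflₑ-half4 a' b' s d)))) c
    (keep-or-flip (λ s → half4 a' s c d) (suc zero) (λ s → proj₁ (proj₂ (reflₑ-half4 a' s c d))) b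
    (keep-or-flip (λ s → half4 s b c d) zero (λ s → proj₁ (reflₑ-half4 s b c d)) a p a') b') c') d'

  Hurwitz-generated : (∀ k → P (e k)) → ∀ a b c d → P (half4 a b c d) → ∀ x → Hurwitz x → P x
  Hurwitz-generated Pe a b c d Ph x (inj₁ (k , Sign.+ , refl)) = subst P (sym (·-identityˡ (e k))) (Pe k)
  Hurwitz-generated Pe a b c d Ph x (inj₁ (k , Sign.- , refl)) = subst P (reflₑ-e k) (closed k _ (Pe k))
  Hurwitz-generated Pe a b c d Ph x (inj₂ (a' , b' , c' , d' , refl)) = half4-reachable a b c d Ph a' b' c' d'

≐-sym : ∀ {m} {P P' : VSet m} → P ≐ P' → P' ≐ P
≐-sym P≐P' v = mk⇔ (Equivalence.from (P≐P' v)) (Equivalence.to (P≐P' v))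

≐-IsSubsystem : ∀ {m} {Φ P P' : VSet m} → P ≐ P' → IsSubsystem Φ P → IsSubsystem Φ P'
≐-IsSubsystem P≐P' (P⊆Φ , (v , Pv) , closed) =
  (λ v → P⊆Φ v ∘ from v) , (v , to v Pv) , λ α β α∈ β∈ → to _ (closed α β (from α α∈) (from β β∈))
  where
  to = λ v → Equivalence.to (P≐P' v)
  from = λ v → Equivalence.from (P≐P' v)

≐-IsTypeD : ∀ {m k} {P P' : VSet m} → P ≐ P' → IsTypeD k P → IsTypeD k P'
≐-IsTypeD P≐P' (ε , norm , orth , P≐D) = ε , norm , orth , λ v →
  mk⇔ (Equivalence.to (P≐D v) ∘ Equivalence.from (P≐P' v)) (Equivalence.to (P≐P' v) ∘ Equivalence.from (P≐D v))

lin-pair : ∀ {k m} (F : Fin k → V m) (ε : Fin 4 → V k) i j s t →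
           lin F ((sgn s · ε i) ⊕ (sgn t · ε j)) ≡ (sgn s · lin F (ε i)) ⊕ (sgn t · lin F (ε j))
lin-pair F ε i j s t = trans (lin-⊕ F (sgn s · ε i) (sgn t · ε j)) (cong₂ _⊕_ (lin-· F (sgn s) (ε i)) (lin-· F (sgn t) (ε j)))

lin-DRootsOf : ∀ {k m} (F : Fin k → V m) (ε : Fin 4 → V k) {x} → DRootsOf ε x → DRootsOf (lin F ∘ ε) (lin F x)
lin-DRootsOf F ε (i , j , i≢j , s , t , refl) = i , j , i≢j , s , t , lin-pair F ε i j s t

DRootsOf-lin : ∀ {k m} (F : Fin k → V m) (ε : Fin 4 → V k) {v} → DRootsOf (lin F ∘ ε) v →
               Σ (V k) λ x → DRootsOf ε x × v ≡ lin F x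
DRootsOf-lin F ε (i , j , i≢j , s , t , refl) =
  _ , (i , j , i≢j , s , t , refl) , sym (lin-pair F ε i j s t)

DRootsOf-coordinates : ∀ {m} (ε : Fin 4 → V m) {v} → DRootsOf ε v → Σ (V 4) λ y → lin ε y ≡ v
DRootsOf-coordinates ε (i , j , _ , s , t , refl) =
  (sgn s · e i) ⊕ (sgn t · e j) , trans (lin-pair ε e i j s t) (cong₂ (λ x y → sgn s · x ⊕ sgn t · y) (lin-e ε i) (lin-e ε j))

LexPos-neg : ∀ {m} {v : V m} → LexPos v → ¬ LexPos (neg v)
LexPos-neg {v = x ∷ v} (here 0<x)     (here 0<-x)    = ℚₚ.<-asym 0<x (subst (ℚ._< 0ℚ) (ℚ-neg-involutive x) (ℚₚ.neg-antimono-< 0<-x))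
LexPos-neg {v = x ∷ v} (here 0<x)     (there -x≡0 _) = ℚₚ.<-irrefl (sym (trans (sym (ℚ-neg-involutive x)) (cong ℚ.-_ -x≡0))) 0<x
LexPos-neg {v = x ∷ v} (there x≡0 _)  (here 0<-x)    = ℚₚ.<-irrefl (sym (cong ℚ.-_ x≡0)) 0<-x
LexPos-neg             (there _ v₊)   (there _ -v₊)  = LexPos-neg v₊ -v₊

positive-∉R± : ∀ {n m} (R : Fin n → V m) → (∀ i → LexPos (R i)) →
               ∀ {β} → LexPos β → (∀ i → β ≢ R i) → ¬ InR± R β
positive-∉R± R R₊ β₊ β≢R (i , inj₁ β≡Rᵢ)  = β≢R i β≡Rᵢ
positive-∉R± R R₊ β₊ β≢R (i , inj₂ β≡-Rᵢ) = LexPos-neg (R₊ i) (subst LexPos β≡-Rᵢ β₊)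

-- Simply laced root sets relative to an orthogonal basis of roots

reflection≡ : ∀ {m} {γ δ r : V m} {c} → B γ δ ≡ c → δ ⊖ c · γ ≡ r → refl-s γ δ ≡ r
reflection≡ refl eq = eq

data Pairing (x : ℚ) : Set where
  pair-2 : x ≡ ℚ.- 2ℚ → Pairing x
  pair-1 : x ≡ ℚ.- 1ℚ → Pairing x
  pair0  : x ≡ 0ℚ     → Pairing x
  pair1  : x ≡ 1ℚ     → Pairing x
  pair2  : x ≡ 2ℚ     → Pairing x

data Trit (x : ℚ) : Set where
  trit-1 : x ≡ ℚ.- 1ℚ → Trit x
  trit0  : x ≡ 0ℚ     → Trit x
  trit1  : x ≡ 1ℚ     → Trit x

record IsSimplyLacedRoots {m} (Φ : VSet m) : Set where
  field
    norm       : ∀ {α} → Φ α → B α α ≡ 2ℚ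
    pairing    : ∀ {α β} → Φ α → Φ β → Pairing (B α β)
    neg-closed : ∀ {α} → Φ α → Φ (neg α)
    sum-closed : ∀ {α β} → Φ α → Φ β → B α β ≡ ℚ.- 1ℚ → Φ (α ⊕ β)

  B≡2⇒≡ : ∀ {α β} → Φ α → Φ β → B α β ≡ 2ℚ → α ≡ β
  B≡2⇒≡ {α} {β} Φα Φβ Bαβ≡2 = ⊖≡𝟘⇒≡ α β (B[v,v]≡0⇒v≡𝟘 (α ⊖ β) (begin
    B (α ⊖ β) (α ⊖ β)
      ≡⟨ B-⊖ˡ α β (α ⊖ β) ⟩
    B α (α ⊖ β) ℚ.- B β (α ⊖ β)
      ≡⟨ cong₂ ℚ._-_ (B-⊖ʳ α β α) (B-⊖ʳ α β β) ⟩
    (B α α ℚ.- B α β) ℚ.- (B β α ℚ.- B β β)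
      ≡⟨ cong₂ (λ x y → (x ℚ.- B α β) ℚ.- (y ℚ.- B β β)) (norm Φα) (B-comm β α) ⟩
    (2ℚ ℚ.- B α β) ℚ.- (B α β ℚ.- B β β)
      ≡⟨ cong₂ (λ x y → (2ℚ ℚ.- x) ℚ.- (x ℚ.- y)) Bαβ≡2 (norm Φβ) ⟩
    (2ℚ ℚ.- 2ℚ) ℚ.- (2ℚ ℚ.- 2ℚ)
      ≡⟨⟩
    0ℚ ∎))

  B≡-2⇒≡neg : ∀ {α β} → Φ α → Φ β → B α β ≡ ℚ.- 2ℚ → α ≡ neg β
  B≡-2⇒≡neg {α} {β} Φα Φβ eq = B≡2⇒≡ Φα (neg-closed Φβ) (trans (B-negʳ β α) (cong ℚ.-_ eq))

  refl-closed : ∀ {α β} → Φ α → Φ β → Φ (refl-s α β)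
  refl-closed {α} {β} Φα Φβ with pairing Φα Φβ
  ... | pair0 eq  = subst Φ (sym (reflection≡ eq (⊖-0· β α))) Φβ
  ... | pair1 eq  = subst Φ (sym (reflection≡ eq (⊖-1· β α)))
                      (sum-closed Φβ (neg-closed Φα) (trans (B-negʳ α β) (cong ℚ.-_ (trans (B-comm β α) eq))))
  ... | pair-1 eq = subst Φ (sym (reflection≡ eq (⊖-[-1]· β α))) (sum-closed Φβ Φα (trans (B-comm β α) eq))
  ... | pair2 eq  = subst (λ γ → Φ (refl-s γ β)) (sym (B≡2⇒≡ Φα Φβ eq))
                      (subst Φ (sym (reflection≡ (norm Φβ) (⊖-2·-self β))) (neg-closed Φβ))
  ... | pair-2 eq = subst (λ γ → Φ (refl-s γ β)) (sym (B≡-2⇒≡neg Φα Φβ eq))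
                      (subst Φ (sym (reflection≡ (trans (B-negˡ β β) (cong ℚ.-_ (norm Φβ))) (⊖-[-2]·-neg β))) (neg-closed Φβ))

module OrthogonalRootBasis {n m} {Φ : VSet m} (isΦ : IsSimplyLacedRoots Φ) (R : Fin n → V m)
  (RΦ : ∀ i → Φ (R i)) (orth : Orthogonal R) (expand : ∀ {α} → Φ α → α ≡ lincomb R (coord R α)) where

  open IsSimplyLacedRoots isΦ

  normR : ∀ i → B (R i) (R i) ≡ 2ℚ
  normR i = norm (RΦ i)

  open OrthogonalFrame R orth normR

  B-negR : ∀ i → B (neg (R i)) (R i) ≡ ℚ.- 2ℚ
  B-negR i = trans (B-negˡ (R i) (R i)) (cong ℚ.-_ (normR i))

  B[±Rᵢ,Rᵢ]≡±2 : ∀ {v} i → (v ≡ R i ⊎ v ≡ neg (R i)) → B v (R i) ≡ 2ℚ ⊎ B v (R i) ≡ ℚ.- 2ℚ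
  B[±Rᵢ,Rᵢ]≡±2 i (inj₁ refl) = inj₁ (normR i)
  B[±Rᵢ,Rᵢ]≡±2 i (inj₂ refl) = inj₂ (B-negR i)

  InR±? : ∀ {v} → Φ v → Dec (InR± R v)
  InR±? {v} Φv with Finₚ.any? (λ i → (B v (R i) ℚₚ.≟ 2ℚ) ⊎-dec (B v (R i) ℚₚ.≟ ℚ.- 2ℚ))
  ... | yes (i , inj₁ eq) = yes (i , inj₁ (B≡2⇒≡ Φv (RΦ i) eq))
  ... | yes (i , inj₂ eq) = yes (i , inj₂ (B≡-2⇒≡neg Φv (RΦ i) eq))
  ... | no ¬±2 = no λ (i , v≡±R) → ¬±2 (i , B[±Rᵢ,Rᵢ]≡±2 i v≡±R)

  trit : ∀ {α} → Φ α → ¬ InR± R α → ∀ i → Trit (B α (R i))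
  trit {α} Φα α∉±R i with pairing Φα (RΦ i)
  ... | pair-2 eq = ⊥-elim (α∉±R (i , inj₂ (B≡-2⇒≡neg Φα (RΦ i) eq)))
  ... | pair-1 eq = trit-1 eq
  ... | pair0 eq  = trit0 eq
  ... | pair1 eq  = trit1 eq
  ... | pair2 eq  = ⊥-elim (α∉±R (i , inj₁ (B≡2⇒≡ Φα (RΦ i) eq)))

  support : V m → Subset n
  support v = Vec.tabulate λ i → if does (B v (R i) ℚₚ.≟ 0ℚ) then outside else inside

  support-entry : ∀ v i → lookup (support v) i ≡ inside ⇔ B v (R i) ≢ 0ℚ
  support-entry v i rewrite Vecₚ.lookup∘tabulate (λ i → if does (B v (R i) ℚₚ.≟ 0ℚ) then outside else inside) i
    with B v (R i) ℚₚ.≟ 0ℚ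
  ... | yes B≡0 = mk⇔ (λ ()) (λ B≢0 → ⊥-elim (B≢0 B≡0))
  ... | no B≢0  = mk⇔ (λ _ → B≢0) (λ _ → refl)

  B≢0⇒∈support : ∀ v i → B v (R i) ≢ 0ℚ → i ∈ support v
  B≢0⇒∈support v i B≢0 = Vecₚ.lookup⇒[]= i (support v) (Equivalence.from (support-entry v i) B≢0)

  ∈support⇒B≢0 : ∀ v i → i ∈ support v → B v (R i) ≢ 0ℚ
  ∈support⇒B≢0 v i i∈ = Equivalence.to (support-entry v i) (Vecₚ.[]=⇒lookup i∈)

  ∉support⇒B≡0 : ∀ v i → i ∉ support v → B v (R i) ≡ 0ℚ
  ∉support⇒B≡0 v i i∉ with B v (R i) ℚₚ.≟ 0ℚ
  ... | yes B≡0 = B≡0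
  ... | no B≢0  = ⊥-elim (i∉ (B≢0⇒∈support v i B≢0))

  signOf : ℚ → Sign
  signOf x = if does (x ℚₚ.≟ ℚ.- 1ℚ) then Sign.- else Sign.+

  trit≡sgn : ∀ {x} → Trit x → x ≢ 0ℚ → x ≡ sgn (signOf x)
  trit≡sgn (trit-1 refl) _   = refl
  trit≡sgn (trit0 x≡0)   x≢0 = ⊥-elim (x≢0 x≡0)
  trit≡sgn (trit1 refl)  _   = refl

  signs : V m → Fin n → Sign
  signs v i = signOf (B v (R i))

  ∣support∣≡4 : ∀ {α} → Φ α → ¬ InR± R α → ∣ support α ∣ ≡ 4
  ∣support∣≡4 {α} Φα α∉±R = fromℕ-injective _ 4 (begin
    fromℕ ∣ support α ∣                        ≡⟨ sym (sum-characteristic (support α) _ square∈ square∉) ⟩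
    sum (λ i → B α (R i) ℚ.* B α (R i))        ≡⟨ parseval α (expand Φα) ⟩
    2ℚ ℚ.* B α α                               ≡⟨ cong (2ℚ ℚ.*_) (norm Φα) ⟩
    fromℕ 4                                    ∎)
    where
    square∈ : ∀ i → i ∈ support α → B α (R i) ℚ.* B α (R i) ≡ 1ℚ
    square∈ i i∈ with trit Φα α∉±R i
    ... | trit-1 eq = cong₂ ℚ._*_ eq eq
    ... | trit0 eq  = ⊥-elim (∈support⇒B≢0 α i i∈ eq)
    ... | trit1 eq  = cong₂ ℚ._*_ eq eq
    square∉ : ∀ i → i ∉ support α → B α (R i) ℚ.* B α (R i) ≡ 0ℚ
    square∉ i i∉ = cong₂ ℚ._*_ (∉support⇒B≡0 α i i∉) (∉support⇒B≡0 α i i∉)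

  ≡halfSum : ∀ {α} → Φ α → ¬ InR± R α → α ≡ halfSumR R (support α) (signs α)
  ≡halfSum {α} Φα α∉±R = trans (expand Φα) (lincomb-congʳ R coefficient≡)
    where
    coefficient≡ : ∀ i → coord R α i ≡ ½ ℚ.* (indicator R (support α) i ℚ.* sgn (signs α i))
    coefficient≡ i with B α (R i) ℚₚ.≟ 0ℚ
    ... | yes B≡0 = cong (½ ℚ.*_) (begin
      B α (R i)
        ≡⟨ B≡0 ⟩
      0ℚ
        ≡⟨ sym (ℚₚ.*-zeroˡ (sgn (signs α i))) ⟩
      0ℚ ℚ.* sgn (signs α i)
        ≡⟨ cong (ℚ._* _) (sym (indicator-∉ R (support α) (λ i∈ → ∈support⇒B≢0 α i i∈ B≡0))) ⟩
      indicator R (support α) i ℚ.* sgn (signs α i) ∎)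
    ... | no B≢0 = cong (½ ℚ.*_) (begin
      B α (R i)
        ≡⟨ trit≡sgn (trit Φα α∉±R i) B≢0 ⟩
      sgn (signs α i)
        ≡⟨ sym (ℚₚ.*-identityˡ (sgn (signs α i))) ⟩
      1ℚ ℚ.* sgn (signs α i)
        ≡⟨ cong (ℚ._* _) (sym (indicator-∈ R (support α) (B≢0⇒∈support α i B≢0))) ⟩
      indicator R (support α) i ℚ.* sgn (signs α i) ∎)

  InSpan-refl : ∀ {Q x y} → InSpan R Q x → InSpan R Q y → InSpan R Q (refl-s x y)
  InSpan-refl {Q} {x} {y} (cx , cx∉ , refl) (cy , cy∉ , refl) =
    (λ i → cy i ℚ.- B x y ℚ.* cx i) ,
    (λ i i∉ → trans (cong₂ (λ a b → a ℚ.- B x y ℚ.* b) (cy∉ i i∉) (cx∉ i i∉))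
                    (solve 1 (λ b → con 0ℚ :- b :* con 0ℚ := con 0ℚ) refl (B x y))) ,
    trans (cong (lincomb R cy ⊖_) (sym (lincomb-* R (B x y) cx))) (lincomb-⊖ R cy (λ i → B x y ℚ.* cx i))

  module QuadrupleCoordinates (Q : Subset n) (en : Enumeration Q 4) where

    open Enumeration en public

    Rq : Fin 4 → V m
    Rq = R ∘ at

    Rq-orthogonal : Orthogonal Rq
    Rq-orthogonal k l k≢l = orth (at k) (at l) (k≢l ∘ at-injective k l)

    toV : V 4 → V m
    toV = lin Rq

    open OrthogonalFrame Rq Rq-orthogonal (normR ∘ at) public using () renaming (B-frame to B-toV)

    refl-toV : ∀ x y → refl-s (toV x) (toV y) ≡ toV (y ⊖ (2ℚ ℚ.* B x y) · x)
    refl-toV x y = begin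
      toV y ⊖ B (toV x) (toV y) · toV x            ≡⟨ cong (λ c → toV y ⊖ c · toV x) (B-toV x y) ⟩
      toV y ⊖ (2ℚ ℚ.* B x y) · toV x               ≡⟨ cong (toV y ⊖_) (sym (lin-· Rq (2ℚ ℚ.* B x y) x)) ⟩
      toV y ⊖ toV ((2ℚ ℚ.* B x y) · x)             ≡⟨ sym (lin-⊖ Rq y _) ⟩
      toV (y ⊖ (2ℚ ℚ.* B x y) · x)                 ∎

    toV-sgn-e : ∀ s k → toV (sgn s · e k) ≡ sgn s · R (at k)
    toV-sgn-e s k = trans (lin-· Rq (sgn s) (e k)) (cong (sgn s ·_) (lin-e Rq k))

    toV-+e : ∀ k → toV (sgn Sign.+ · e k) ≡ R (at k)
    toV-+e k = trans (toV-sgn-e Sign.+ k) (·-identityˡ (R (at k)))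

    toV--e : ∀ k → toV (sgn Sign.- · e k) ≡ neg (R (at k))
    toV--e k = trans (toV-sgn-e Sign.- k) (sym (neg≡-1· (R (at k))))

    lincomb-Rq-InSpan : ∀ d → InSpan R Q (lincomb Rq d)
    lincomb-Rq-InSpan d = (λ i → sum (λ l → δ (at l) (d l) i)) ,
      (λ i i∉ → sum-zero _ (λ l → δ-other (at l) i (d l) (λ i≡ → i∉ (subst (_∈ Q) (sym i≡) (at-∈ l))))) ,
      lincomb-∘ R at d

    toV-InSpan : ∀ x → InSpan R Q (toV x)
    toV-InSpan x = lincomb-Rq-InSpan (lookup x)

    restrict : (Fin n → Sign) → V 4
    restrict ε = half4 (ε (at zero)) (ε (at (suc zero))) (ε (at (suc (suc zero)))) (ε (at (suc (suc (suc zero)))))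

    lookup-restrict : ∀ ε l → lookup (restrict ε) l ≡ ½ ℚ.* sgn (ε (at l))
    lookup-restrict ε zero                   = refl
    lookup-restrict ε (suc zero)             = refl
    lookup-restrict ε (suc (suc zero))       = refl
    lookup-restrict ε (suc (suc (suc zero))) = refl

    halfSum≡toV : ∀ ε → halfSumR R Q ε ≡ toV (restrict ε)
    halfSum≡toV ε = trans (lincomb-congʳ R coefficient≡) (sym (lincomb-∘ R at (lookup (restrict ε))))
      where
      coefficient≡ : ∀ i → ½ ℚ.* (indicator R Q i ℚ.* sgn (ε i)) ≡ sum (λ l → δ (at l) (lookup (restrict ε) l) i)
      coefficient≡ i with i Subsetₚ.∈? Q
      ... | no i∉ = begin
        ½ ℚ.* (indicator R Q i ℚ.* sgn (ε i))
          ≡⟨ cong (λ z → ½ ℚ.* (z ℚ.* sgn (ε i))) (indicator-∉ R Q i∉) ⟩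
        ½ ℚ.* (0ℚ ℚ.* sgn (ε i))
          ≡⟨ solve 2 (λ h s → h :* (con 0ℚ :* s) := con 0ℚ) refl ½ (sgn (ε i)) ⟩
        0ℚ
          ≡⟨ sym (sum-zero _ (λ l → δ-other (at l) i (lookup (restrict ε) l) (λ i≡ → i∉ (subst (_∈ Q) (sym i≡) (at-∈ l))))) ⟩
        sum (λ l → δ (at l) (lookup (restrict ε) l) i) ∎
      ... | yes i∈ with at-surjective i i∈
      ...   | l , refl = begin
        ½ ℚ.* (indicator R Q (at l) ℚ.* sgn (ε (at l)))
          ≡⟨ cong (λ z → ½ ℚ.* (z ℚ.* sgn (ε (at l)))) (indicator-∈ R Q i∈) ⟩
        ½ ℚ.* (1ℚ ℚ.* sgn (ε (at l)))
          ≡⟨ cong (½ ℚ.*_) (ℚₚ.*-identityˡ (sgn (ε (at l)))) ⟩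
        ½ ℚ.* sgn (ε (at l))
          ≡⟨ sym (lookup-restrict ε l) ⟩
        lookup (restrict ε) l
          ≡⟨ sym (δ-same (at l) _) ⟩
        δ (at l) (lookup (restrict ε) l) (at l)
          ≡⟨ sym (sum-single l _ (λ l' l'≢l → δ-other (at l') (at l) (lookup (restrict ε) l') (l'≢l ∘ at-injective l' l ∘ sym))) ⟩
        sum (λ l' → δ (at l') (lookup (restrict ε) l') (at l)) ∎

    extend : (Fin 4 → Sign) → Fin n → Sign
    extend σ i with i Subsetₚ.∈? Q
    ... | yes i∈ = σ (proj₁ (at-surjective i i∈))
    ... | no _   = Sign.+

    extend-at : ∀ σ l → extend σ (at l) ≡ σ l
    extend-at σ l with at l Subsetₚ.∈? Q
    ... | yes i∈ = cong σ (at-injective _ l (proj₂ (at-surjective (at l) i∈)))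
    ... | no i∉  = ⊥-elim (i∉ (at-∈ l))

    ΨQ→Hurwitz : ∀ {v} → ΨQ R Q v → Σ (V 4) λ x → Hurwitz x × v ≡ toV x
    ΨQ→Hurwitz (inj₁ (i , i∈ , v≡±R)) with at-surjective i i∈
    ΨQ→Hurwitz (inj₁ (_ , _ , inj₁ refl)) | k , refl = sgn Sign.+ · e k , inj₁ (k , Sign.+ , refl) , sym (toV-+e k)
    ΨQ→Hurwitz (inj₁ (_ , _ , inj₂ refl)) | k , refl = sgn Sign.- · e k , inj₁ (k , Sign.- , refl) , sym (toV--e k)
    ΨQ→Hurwitz (inj₂ (ε , refl)) =
      restrict ε ,
      inj₂ (ε (at zero) , ε (at (suc zero)) , ε (at (suc (suc zero))) , ε (at (suc (suc (suc zero)))) , refl) ,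
      halfSum≡toV ε

    Hurwitz→ΨQ : ∀ {x} → Hurwitz x → ΨQ R Q (toV x)
    Hurwitz→ΨQ (inj₁ (k , Sign.+ , refl)) = inj₁ (at k , at-∈ k , inj₁ (toV-+e k))
    Hurwitz→ΨQ (inj₁ (k , Sign.- , refl)) = inj₁ (at k , at-∈ k , inj₂ (toV--e k))
    Hurwitz→ΨQ (inj₂ (a , b , c , d , refl)) = inj₂ (ε , sym (trans (halfSum≡toV ε) (cong toV restrict-ε)))
      where
      σ : Fin 4 → Sign
      σ zero = a
      σ (suc zero) = b
      σ (suc (suc zero)) = c
      σ (suc (suc (suc zero))) = d
      ε = extend σ
      restrict-ε : restrict ε ≡ half4 a b c d
      restrict-ε = half4-cong (extend-at σ zero) (extend-at σ (suc zero))
                              (extend-at σ (suc (suc zero))) (extend-at σ (suc (suc (suc zero))))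

    ΨQ-generated : (P : VSet m) → (∀ k v → P v → P (refl-s (R (at k)) v)) → (∀ k → P (R (at k))) →
                   ∀ ε → P (halfSumR R Q ε) → ΨQ R Q ⊆ᵥ P
    ΨQ-generated P closed P-R ε P-half v v∈ΨQ with ΨQ→Hurwitz v∈ΨQ
    ... | x , hx , refl = Hurwitz-generated (λ k → subst P (sym (lin-e Rq k)) (P-R k))
                            (ε (at zero)) (ε (at (suc zero))) (ε (at (suc (suc zero)))) (ε (at (suc (suc (suc zero)))))
                            (subst P (halfSum≡toV ε) P-half) x hx
      where
      closed-toV : ∀ k y → P (toV y) → P (toV (reflₑ k y))
      closed-toV k y Py = subst P (trans (cong (λ r → refl-s r (toV y)) (sym (lin-e Rq k))) (refl-toV (e k) y)) (closed k (toV y) Py)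
      open HurwitzGeneration (P ∘ toV) closed-toV

  InSpan⇒support⊆ : ∀ {S v} → InSpan R S v → ∀ i → i ∈ support v → i ∈ S
  InSpan⇒support⊆ {S} {v} (c , c∉ , v≡) i i∈ with i Subsetₚ.∈? S
  ... | yes i∈S = i∈S
  ... | no i∉S  = ⊥-elim (∈support⇒B≢0 v i i∈ (½*x≡0⇒x≡0 _ (trans (sym (coefficient c v v≡ i)) (c∉ i i∉S))))

  support-of-InSpan : ∀ {S γ} → Φ γ → ¬ InR± R γ → InSpan R S γ → ∣ S ∣ ≡ 4 → support γ ≡ S
  support-of-InSpan Φγ γ∉±R γ∈ ∣S∣≡4 =
    ⊆∧∣∣≡⇒≡ (InSpan⇒support⊆ γ∈ _) (trans (∣support∣≡4 Φγ γ∉±R) (sym ∣S∣≡4))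

  module SupportQuadruple {α} (Φα : Φ α) (α∉±R : ¬ InR± R α) where

    Q : Subset n
    Q = support α

    open QuadrupleCoordinates Q (enumeration Q (∣support∣≡4 Φα α∉±R)) public

    ΨQ-minimal : ∀ Ψ → (∀ β γ → Ψ β → Ψ γ → Ψ (refl-s β γ)) → (∀ i → i ∈ Q → Ψ (R i)) → Ψ α →
                 ΨQ R Q ⊆ᵥ Ψ
    ΨQ-minimal Ψ closed Ψ-R Ψα =
      ΨQ-generated Ψ (λ k v → closed (R (at k)) v (Ψ-R (at k) (at-∈ k))) (λ k → Ψ-R (at k) (at-∈ k))
                                   (signs α) (subst Ψ (≡halfSum Φα α∉±R) Ψα)

    ΨQ⊆Φ : ΨQ R Q ⊆ᵥ Φ
    ΨQ⊆Φ = ΨQ-minimal Φ (λ _ _ → refl-closed) (λ i _ → RΦ i) Φα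

    ΨQ⊆Span : ∀ v → ΨQ R Q v → InSpan R Q v
    ΨQ⊆Span v v∈ = subst (InSpan R Q) (sym (proj₂ (proj₂ (ΨQ→Hurwitz v∈)))) (toV-InSpan (proj₁ (ΨQ→Hurwitz v∈)))

    SpanΦ⊆ΨQ : ∀ v → SpanΦ R Φ Q v → ΨQ R Q v
    SpanΦ⊆ΨQ v (Φv , v∈Span) with InR±? Φv
    ... | yes (i , v≡±R) = inj₁ (i , InSpan⇒support⊆ v∈Span i (B≢0⇒∈support v i (±2≢0 (B[±Rᵢ,Rᵢ]≡±2 i v≡±R))) , v≡±R)
      where
      ±2≢0 : ∀ {x} → x ≡ 2ℚ ⊎ x ≡ ℚ.- 2ℚ → x ≢ 0ℚ
      ±2≢0 (inj₁ refl) ()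
      ±2≢0 (inj₂ refl) ()
    ... | no v∉±R = inj₂ (signs v , subst (λ S → v ≡ halfSumR R S (signs v))
                      (support-of-InSpan Φv v∉±R v∈Span (∣support∣≡4 Φα α∉±R)) (≡halfSum Φv v∉±R))

    SpanΦ≐ΨQ : SpanΦ R Φ Q ≐ ΨQ R Q
    SpanΦ≐ΨQ v = mk⇔ (SpanΦ⊆ΨQ v) λ v∈ → ΨQ⊆Φ v v∈ , ΨQ⊆Span v v∈

    ΨQ-subsystem : IsSubsystem Φ (ΨQ R Q)
    ΨQ-subsystem = ΨQ⊆Φ , (α , inj₂ (signs α , ≡halfSum Φα α∉±R)) , λ β γ β∈ γ∈ →
      SpanΦ⊆ΨQ _ (refl-closed (ΨQ⊆Φ β β∈) (ΨQ⊆Φ γ γ∈) , InSpan-refl (ΨQ⊆Span β β∈) (ΨQ⊆Span γ γ∈))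

    ΨQ-typeD : IsTypeD 4 (ΨQ R Q)
    ΨQ-typeD = toV ∘ E4 , (λ k → trans (B-toV (E4 k) (E4 k)) (E4-norm k)) ,
      (λ k l k≢l → trans (B-toV (E4 k) (E4 l)) (trans (cong (2ℚ ℚ.*_) (E4-orthogonal k l k≢l)) (ℚₚ.*-zeroʳ 2ℚ))) ,
      λ v → mk⇔ (to v) (from v)
      where
      to : ∀ v → ΨQ R Q v → DRootsOf (toV ∘ E4) v
      to v v∈ = let (x , hx , v≡) = ΨQ→Hurwitz v∈ in
        subst (DRootsOf (toV ∘ E4)) (sym v≡) (lin-DRootsOf Rq E4 (Hurwitz→DRootsOfE4 hx))
      from : ∀ v → DRootsOf (toV ∘ E4) v → ΨQ R Q v
      from v v∈ = let (x , dx , v≡) = DRootsOf-lin Rq E4 v∈ in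
        subst (ΨQ R Q) (sym v≡) (Hurwitz→ΨQ (DRootsOfE4→Hurwitz dx))

    SpanΦ-D4 : SubsystemOfTypeD Φ 4 (SpanΦ R Φ Q)
    SpanΦ-D4 = ≐-IsSubsystem (≐-sym SpanΦ≐ΨQ) ΨQ-subsystem , ≐-IsTypeD (≐-sym SpanΦ≐ΨQ) ΨQ-typeD

  support-IsSupport : ∀ {α} → Φ α → IsSupport R α (support α)
  support-IsSupport {α} Φα = coord R α , expand Φα , λ i →
    (λ i∈ c≡0 → ∈support⇒B≢0 α i i∈ (½*x≡0⇒x≡0 _ c≡0)) ,
    (λ c≢0 → B≢0⇒∈support α i λ B≡0 → c≢0 (trans (cong (½ ℚ.*_) B≡0) (ℚₚ.*-zeroʳ ½)))

  IsSupport⇒≡support : ∀ {α S} → IsSupport R α S → support α ≡ S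
  IsSupport⇒≡support {α} {S} (c , α≡ , c≢0⇔) = Subsetₚ.⊆-antisym
    (λ {i} i∈ → proj₂ (c≢0⇔ i) λ cᵢ≡0 → ∈support⇒B≢0 α i i∈ (½*x≡0⇒x≡0 _ (trans (sym (coefficient c α α≡ i)) cᵢ≡0)))
    (λ {i} i∈ → B≢0⇒∈support α i λ B≡0 → proj₁ (c≢0⇔ i) i∈ (trans (coefficient c α α≡ i) (trans (cong (½ ℚ.*_) B≡0) (ℚₚ.*-zeroʳ ½))))

  B[±R,±R]≢1 : ∀ {u v} → InR± R u → InR± R v → B u v ≢ 1ℚ
  B[±R,±R]≢1 (i , u≡±R) (j , v≡±R) = ≢1 (±R-pairing u≡±R v≡±R)
    where
    RR : B (R i) (R j) ≡ 2ℚ ⊎ B (R i) (R j) ≡ 0ℚ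
    RR with i Finₚ.≟ j
    ... | yes refl = inj₁ (normR i)
    ... | no i≢j   = inj₂ (orth i j i≢j)
    ±R-pairing : ∀ {u v} → (u ≡ R i ⊎ u ≡ neg (R i)) → (v ≡ R j ⊎ v ≡ neg (R j)) →
                 B u v ≡ B (R i) (R j) ⊎ B u v ≡ ℚ.- B (R i) (R j)
    ±R-pairing (inj₁ refl) (inj₁ refl) = inj₁ refl
    ±R-pairing (inj₁ refl) (inj₂ refl) = inj₂ (B-negʳ (R j) (R i))
    ±R-pairing (inj₂ refl) (inj₁ refl) = inj₂ (B-negˡ (R i) (R j))
    ±R-pairing (inj₂ refl) (inj₂ refl) = inj₁ (trans (B-negˡ (R i) (neg (R j)))
      (trans (cong ℚ.-_ (B-negʳ (R j) (R i))) (ℚ-neg-involutive (B (R i) (R j)))))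
    ≢1 : ∀ {x} → x ≡ B (R i) (R j) ⊎ x ≡ ℚ.- B (R i) (R j) → x ≢ 1ℚ
    ≢1 x≡± x≡1 with RR | x≡±
    ... | inj₁ eq | inj₁ eq' = case (trans (sym x≡1) (trans eq' eq)) of λ ()
    ... | inj₁ eq | inj₂ eq' = case (trans (sym x≡1) (trans eq' (cong ℚ.-_ eq))) of λ ()
    ... | inj₂ eq | inj₁ eq' = case (trans (sym x≡1) (trans eq' eq)) of λ ()
    ... | inj₂ eq | inj₂ eq' = case (trans (sym x≡1) (trans eq' (cong ℚ.-_ eq))) of λ ()

  -- Of the D₄-roots ε₀ + ε₁ and ε₀ + ε₂, which pair to 1, at most one can lie in ±R.
  typeD-root-outside-R± : ∀ {P} → P ⊆ᵥ Φ → IsTypeD 4 P → Σ (V m) λ β → P β × ¬ InR± R β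
  typeD-root-outside-R± {P} P⊆Φ (ε , ε-norm , ε-orth , P≐) = pick (InR±? (P⊆Φ v₁ P₁)) (InR±? (P⊆Φ v₂ P₂))
    where
    0F 1F 2F : Fin 4
    0F = zero
    1F = suc zero
    2F = suc (suc zero)
    v₁ v₂ : V m
    v₁ = (sgn Sign.+ · ε 0F) ⊕ (sgn Sign.+ · ε 1F)
    v₂ = (sgn Sign.+ · ε 0F) ⊕ (sgn Sign.+ · ε 2F)
    P₁ : P v₁
    P₁ = Equivalence.from (P≐ v₁) (0F , 1F , (λ ()) , Sign.+ , Sign.+ , refl)
    P₂ : P v₂
    P₂ = Equivalence.from (P≐ v₂) (0F , 2F , (λ ()) , Sign.+ , Sign.+ , refl)
    B[v₁,v₂]≡1 : B v₁ v₂ ≡ 1ℚ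
    B[v₁,v₂]≡1 = begin
      B v₁ v₂
        ≡⟨ cong₂ B (cong₂ _⊕_ (·-identityˡ (ε 0F)) (·-identityˡ (ε 1F))) (cong₂ _⊕_ (·-identityˡ (ε 0F)) (·-identityˡ (ε 2F))) ⟩
      B (ε 0F ⊕ ε 1F) (ε 0F ⊕ ε 2F)
        ≡⟨ B-⊕ˡ (ε 0F) (ε 1F) _ ⟩
      B (ε 0F) (ε 0F ⊕ ε 2F) ℚ.+ B (ε 1F) (ε 0F ⊕ ε 2F)
        ≡⟨ cong₂ ℚ._+_ (B-⊕ʳ (ε 0F) (ε 2F) (ε 0F)) (B-⊕ʳ (ε 0F) (ε 2F) (ε 1F)) ⟩
      (B (ε 0F) (ε 0F) ℚ.+ B (ε 0F) (ε 2F)) ℚ.+ (B (ε 1F) (ε 0F) ℚ.+ B (ε 1F) (ε 2F))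
        ≡⟨ cong₂ ℚ._+_ (cong₂ ℚ._+_ (ε-norm 0F) (ε-orth 0F 2F λ ())) (cong₂ ℚ._+_ (ε-orth 1F 0F λ ()) (ε-orth 1F 2F λ ())) ⟩
      (1ℚ ℚ.+ 0ℚ) ℚ.+ (0ℚ ℚ.+ 0ℚ)
        ≡⟨⟩
      1ℚ ∎
    pick : Dec (InR± R v₁) → Dec (InR± R v₂) → Σ (V m) λ β → P β × ¬ InR± R β
    pick (no v₁∉)  _         = v₁ , P₁ , v₁∉
    pick (yes _)   (no v₂∉)  = v₂ , P₂ , v₂∉
    pick (yes v₁∈) (yes v₂∈) = ⊥-elim (B[±R,±R]≢1 v₁∈ v₂∈ B[v₁,v₂]≡1)

  -- Ψ lies in the four-dimensional span of ε, which is already spanned by the four orthogonal roots R h, h ∈ H.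
  typeD⊆Span : ∀ {Ψ} (ε : Fin 4 → V m) → Ψ ≐ DRootsOf ε → ∀ H (en : Enumeration H 4) →
               (∀ i → i ∈ H → Ψ (R i)) → ∀ γ → Ψ γ → InSpan R H γ
  typeD⊆Span {Ψ} ε Ψ≐ H en Ψ-R γ γ∈ = subst (InSpan R H) (sym γ≡) (lincomb-Rq-InSpan (λ k → ℚ.1/ (c zero) ℚ.* ℚ.- d k))
    where
    open QuadrupleCoordinates H en
    W : Fin 5 → V m
    W zero    = γ
    W (suc k) = Rq k
    W-coordinates : ∀ j → Σ (V 4) λ y → lin ε y ≡ W j
    W-coordinates zero    = DRootsOf-coordinates ε (Equivalence.to (Ψ≐ γ) γ∈)
    W-coordinates (suc k) = DRootsOf-coordinates ε (Equivalence.to (Ψ≐ (Rq k)) (Ψ-R (at k) (at-∈ k)))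
    dep = dependent 4 5 (ℕₚ.n<1+n 4) (proj₁ ∘ W-coordinates)
    c = proj₁ dep
    d = c ∘ suc
    relation : c zero · γ ⊕ lincomb Rq d ≡ 𝟘
    relation = begin
      lincomb W c
        ≡⟨ sym (lincomb-cong {R = lin ε ∘ proj₁ ∘ W-coordinates} {c = c} (proj₂ ∘ W-coordinates) (λ _ → refl)) ⟩
      lincomb (lin ε ∘ proj₁ ∘ W-coordinates) c
        ≡⟨ sym (lin-lincomb ε (proj₁ ∘ W-coordinates) c) ⟩
      lin ε (lincomb (proj₁ ∘ W-coordinates) c)
        ≡⟨ cong (lin ε) (proj₂ (proj₂ dep)) ⟩
      lin ε 𝟘
        ≡⟨ lin-𝟘 ε ⟩
      𝟘 ∎
    c₀≢0 : c zero ≢ 0ℚ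
    c₀≢0 c₀≡0 with proj₁ (proj₂ dep)
    ... | zero , c₀≢0 = c₀≢0 c₀≡0
    ... | suc k , cₖ≢0 = cₖ≢0 (orthogonal-coefficients-zero Rq Rq-orthogonal (≡2⇒≢0 ∘ normR ∘ at) d 𝟘 (B-𝟘ˡ ∘ Rq) Σ≡𝟘 k)
      where
      Σ≡𝟘 : lincomb Rq d ≡ 𝟘
      Σ≡𝟘 = trans (sym (⊕-identityˡ _)) (trans (cong (_⊕ lincomb Rq d) (sym (trans (cong (_· γ) c₀≡0) (·-zeroˡ γ)))) relation)
    instance _ = ℚ.≢-nonZero c₀≢0
    γ≡ : γ ≡ lincomb Rq (λ k → ℚ.1/ (c zero) ℚ.* ℚ.- d k)
    γ≡ = begin
      γ                                               ≡⟨ sym (·-identityˡ γ) ⟩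
      1ℚ · γ                                          ≡⟨ cong (_· γ) (sym (ℚₚ.*-inverseˡ (c zero))) ⟩
      (ℚ.1/ (c zero) ℚ.* c zero) · γ                  ≡⟨ sym (·-assoc (ℚ.1/ (c zero)) (c zero) γ) ⟩
      ℚ.1/ (c zero) · (c zero · γ)                    ≡⟨ cong (ℚ.1/ (c zero) ·_) (⊕≡𝟘⇒≡neg _ _ relation) ⟩
      ℚ.1/ (c zero) · neg (lincomb Rq d)              ≡⟨ cong (ℚ.1/ (c zero) ·_) (lincomb-neg Rq d) ⟩
      ℚ.1/ (c zero) · lincomb Rq (λ k → ℚ.- d k)      ≡⟨ sym (lincomb-* Rq (ℚ.1/ (c zero)) (λ k → ℚ.- d k)) ⟩
      lincomb Rq (λ k → ℚ.1/ (c zero) ℚ.* ℚ.- d k)    ∎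

  R-InSpan : ∀ {S i} → i ∈ S → InSpan R S (R i)
  R-InSpan {S} {i} i∈ = δ i 1ℚ , (λ j j∉ → δ-other i j 1ℚ λ j≡i → j∉ (subst (_∈ S) (sym j≡i) i∈)) ,
                        sym (trans (lincomb-δ R i 1ℚ) (·-identityˡ (R i)))

  SpanΦ-meet : ∀ S → IsMeetR R (SpanΦ R Φ S) S
  SpanΦ-meet S i = (λ i∈ → RΦ i , R-InSpan i∈) ,
    λ (_ , R∈) → InSpan⇒support⊆ R∈ i (B≢0⇒∈support (R i) i (≡2⇒≢0 (normR i)))

  IsMeetR-unique : ∀ {Ψ H H'} → IsMeetR R Ψ H → IsMeetR R Ψ H' → H ≡ H'
  IsMeetR-unique meet meet' =
    Subsetₚ.⊆-antisym (λ {i} i∈ → proj₂ (meet' i) (proj₁ (meet i) i∈)) (λ {i} i∈ → proj₂ (meet i) (proj₁ (meet' i) i∈))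

  sumR≡2·halfSum : ∀ S → sumR R S ≡ 2ℚ· (halfSumR R S (λ _ → Sign.+))
  sumR≡2·halfSum S = trans
    (lincomb-congʳ R λ i → solve 1 (λ x → x := con ½ :* (x :* con 1ℚ) :+ con ½ :* (x :* con 1ℚ)) refl (indicator R S i))
    (lincomb-+ R _ _)

  ¬InR±-of-half-indicator : ∀ {S α} → α ≡ lincomb R (λ i → ½ ℚ.* indicator R S i) → ¬ InR± R α
  ¬InR±-of-half-indicator {S} {α} α≡ (j , α≡±R) = absurd (j Subsetₚ.∈? S) (B[±Rᵢ,Rᵢ]≡±2 j α≡±R) (coefficient _ α α≡ j)
    where
    ½* = ½ ℚ.*_
    absurd : Dec (j ∈ S) → B α (R j) ≡ 2ℚ ⊎ B α (R j) ≡ ℚ.- 2ℚ → ½* (indicator R S j) ≡ ½* (B α (R j)) → ⊥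
    absurd (yes j∈) (inj₁ B≡2)  eq = case trans (cong ½* (sym (indicator-∈ R S j∈))) (trans eq (cong ½* B≡2)) of λ ()
    absurd (yes j∈) (inj₂ B≡-2) eq = case trans (cong ½* (sym (indicator-∈ R S j∈))) (trans eq (cong ½* B≡-2)) of λ ()
    absurd (no j∉)  (inj₁ B≡2)  eq = case trans (cong ½* (sym (indicator-∉ R S j∉))) (trans eq (cong ½* B≡2)) of λ ()
    absurd (no j∉)  (inj₂ B≡-2) eq = case trans (cong ½* (sym (indicator-∉ R S j∉))) (trans eq (cong ½* B≡-2)) of λ ()

  RootWithDoubleSum RootWithSupport : Subset n → Set
  RootWithDoubleSum S = Σ (V m) λ α → Φ α × sumR R S ≡ 2ℚ· α
  RootWithSupport S   = Σ (V m) λ α → Φ α × ¬ InR± R α × IsSupport R α S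

  Meet𝒬 : Subset n → Set₁
  Meet𝒬 S = Σ (VSet m) λ Ψ → 𝒬 R Φ Ψ × IsMeetR R Ψ S

  quadruple-of-root : ∀ β → Φ β → ¬ InR± R β →
    Σ (Subset n) λ Q →
      ∣ Q ∣ ≡ 4 ×
      (∀ i → i ∉ Q → B β (R i) ≡ 0ℚ) ×
      (∀ i → i ∈ Q → B β (R i) ≢ 0ℚ) ×
      (Σ (Fin n → Sign) λ ε → β ≡ halfSumR R Q ε) ×
      SubsystemOfTypeD Φ 4 (ΨQ R Q) ×
      (∀ i → i ∈ Q → ΨQ R Q (R i)) × ΨQ R Q β ×
      (∀ Ψ → IsSubsystem Φ Ψ → (∀ i → i ∈ Q → Ψ (R i)) → Ψ β → ΨQ R Q ⊆ᵥ Ψ)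
  quadruple-of-root β Φβ β∉±R =
    Q , ∣support∣≡4 Φβ β∉±R , ∉support⇒B≡0 β , ∈support⇒B≢0 β , (signs β , ≡halfSum Φβ β∉±R) ,
    (ΨQ-subsystem , ΨQ-typeD) , (λ i i∈ → inj₁ (i , i∈ , inj₁ refl)) , inj₂ (signs β , ≡halfSum Φβ β∉±R) ,
    λ Ψ (_ , _ , closed) → ΨQ-minimal Ψ closed
    where open SupportQuadruple Φβ β∉±R

  double-sum⇒support : ∀ S → RootWithDoubleSum S → RootWithSupport S
  double-sum⇒support S (α , Φα , sum≡2α) = α , Φα , ¬InR±-of-half-indicator {S} α≡ , c , α≡ , λ i →
    (λ i∈ cᵢ≡0 → case trans (cong (½ ℚ.*_) (sym (indicator-∈ R S i∈))) cᵢ≡0 of λ ()) ,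
    (λ cᵢ≢0 → case i Subsetₚ.∈? S of λ { (yes i∈) → i∈ ; (no i∉) → ⊥-elim (cᵢ≢0 (cong (½ ℚ.*_) (indicator-∉ R S i∉))) })
    where
    c : Fin n → ℚ
    c i = ½ ℚ.* indicator R S i
    α≡ : α ≡ lincomb R c
    α≡ = begin
      α                              ≡⟨ half-double α ⟨
      ½ · (α ⊕ α)                    ≡⟨ cong (½ ·_) sum≡2α ⟨
      ½ · sumR R S                   ≡⟨ lincomb-* R ½ (indicator R S) ⟨
      lincomb R c                    ∎

  support⇒double-sum : ∀ S → RootWithSupport S → RootWithDoubleSum S
  support⇒double-sum S (α , Φα , α∉±R , α-supp) rewrite sym (IsSupport⇒≡support α-supp) =
    halfSumR R Q (λ _ → Sign.+) , ΨQ⊆Φ _ (inj₂ ((λ _ → Sign.+) , refl)) , sumR≡2·halfSum Q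
    where open SupportQuadruple Φα α∉±R

  support⇒D₄ : ∀ S → RootWithSupport S → Dk R Φ 4 S
  support⇒D₄ S (α , Φα , α∉±R , α-supp) rewrite sym (IsSupport⇒≡support α-supp) =
    ∣support∣≡4 Φα α∉±R , SpanΦ-D4
    where open SupportQuadruple Φα α∉±R

  D₄⇒support : ∀ S → Dk R Φ 4 S → RootWithSupport S
  D₄⇒support S (∣S∣≡4 , _ , typeD) with typeD-root-outside-R± (λ _ → proj₁) typeD
  ... | β , (Φβ , β∈Span) , β∉±R =
    β , Φβ , β∉±R , subst (IsSupport R β) (support-of-InSpan Φβ β∉±R β∈Span ∣S∣≡4) (support-IsSupport Φβ)

  D₄⇒𝒬 : ∀ S → Dk R Φ 4 S → 𝒬 R Φ (SpanΦ R Φ S) × IsMeetR R (SpanΦ R Φ S) S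
  D₄⇒𝒬 S S∈D₄ = (proj₂ S∈D₄ , S , SpanΦ-meet S , S∈D₄) , SpanΦ-meet S

  𝒬⇒D₄ : ∀ S → Meet𝒬 S → Dk R Φ 4 S
  𝒬⇒D₄ S (Ψ , (_ , H , H-meet , H∈D₄) , S-meet) = subst (Dk R Φ 4) (IsMeetR-unique {Ψ} H-meet S-meet) H∈D₄

  𝒬≐SpanΦ : ∀ Ψ → 𝒬 R Φ Ψ → ∀ H → IsMeetR R Ψ H → SpanΦ R Φ H ≐ Ψ
  𝒬≐SpanΦ Ψ ((Ψ-subsystem , Ψ-typeD) , H' , H'-meet , H'∈D₄) H H-meet v =
    mk⇔ (SpanΦ⊆Ψ v) λ v∈Ψ → Ψ⊆Φ v v∈Ψ , Ψ⊆Span v v∈Ψ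
    where
    Ψ⊆Φ = proj₁ Ψ-subsystem
    ∣H∣≡4 : ∣ H ∣ ≡ 4
    ∣H∣≡4 = trans (cong ∣_∣ (IsMeetR-unique {Ψ} H-meet H'-meet)) (proj₁ H'∈D₄)
    Ψ⊆Span : ∀ γ → Ψ γ → InSpan R H γ
    Ψ⊆Span = typeD⊆Span (proj₁ Ψ-typeD) (proj₂ (proj₂ (proj₂ Ψ-typeD))) H (enumeration H ∣H∣≡4) (λ i → proj₁ (H-meet i))
    picked = typeD-root-outside-R± Ψ⊆Φ Ψ-typeD
    β = proj₁ picked
    β∈Ψ = proj₁ (proj₂ picked)
    β∉±R = proj₂ (proj₂ picked)
    Φβ = Ψ⊆Φ β β∈Ψ
    open SupportQuadruple Φβ β∉±R
    Q≡H : Q ≡ H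
    Q≡H = support-of-InSpan Φβ β∉±R (Ψ⊆Span β β∈Ψ) ∣H∣≡4
    SpanΦ⊆Ψ : ∀ v → SpanΦ R Φ H v → Ψ v
    SpanΦ⊆Ψ v v∈ = ΨQ-minimal Ψ (proj₂ (proj₂ Ψ-subsystem)) (λ i i∈Q → proj₁ (H-meet i) (subst (i ∈_) Q≡H i∈Q)) β∈Ψ v
      (SpanΦ⊆ΨQ v (subst (λ S → SpanΦ R Φ S v) (sym Q≡H) v∈))

  root-in-unique-D₄ : ∀ α → Φ α → ¬ InR± R α →
    Σ (Subset n) λ Q → Dk R Φ 4 Q × InSpan R Q α × IsSupport R α Q × (∀ Q' → Dk R Φ 4 Q' → InSpan R Q' α → Q' ≡ Q)
  root-in-unique-D₄ α Φα α∉±R =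
    Q , (∣support∣≡4 Φα α∉±R , SpanΦ-D4) ,
    (coord R α , (λ i i∉ → trans (cong (½ ℚ.*_) (∉support⇒B≡0 α i i∉)) (ℚₚ.*-zeroʳ ½)) , expand Φα) ,
    support-IsSupport Φα , λ Q' Q'∈D₄ α∈Span → sym (support-of-InSpan Φα α∉±R α∈Span (proj₁ Q'∈D₄))
    where open SupportQuadruple Φα α∉±R

-- The root system Dₙ

sgn-* : ∀ s t → sgn s ℚ.* sgn t ≡ sgn (s Sign.* t)
sgn-* Sign.+ Sign.+ = refl
sgn-* Sign.+ Sign.- = refl
sgn-* Sign.- Sign.+ = refl
sgn-* Sign.- Sign.- = refl

sgn-opposite : ∀ s → ℚ.- sgn s ≡ sgn (opposite s)
sgn-opposite Sign.+ = refl
sgn-opposite Sign.- = refl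

sgn+sgn-opposite : ∀ s → sgn s ℚ.+ sgn (opposite s) ≡ 0ℚ
sgn+sgn-opposite Sign.+ = refl
sgn+sgn-opposite Sign.- = refl

s*t≡-⇒t≡opposite : ∀ s t → s Sign.* t ≡ Sign.- → t ≡ opposite s
s*t≡-⇒t≡opposite Sign.+ Sign.- _ = refl
s*t≡-⇒t≡opposite Sign.- Sign.+ _ = refl

Trit-sgn : ∀ s → Trit (sgn s)
Trit-sgn Sign.+ = trit1 refl
Trit-sgn Sign.- = trit-1 refl

Trit-sgn* : ∀ s {x} → Trit x → Trit (sgn s ℚ.* x)
Trit-sgn* s (trit-1 refl) = subst Trit (sym (sgn-* s Sign.-)) (Trit-sgn (s Sign.* Sign.-))
Trit-sgn* s (trit0 refl)  = trit0 (ℚₚ.*-zeroʳ (sgn s))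
Trit-sgn* s (trit1 refl)  = subst Trit (sym (sgn-* s Sign.+)) (Trit-sgn (s Sign.* Sign.+))

Trit+Trit : ∀ {x y} → Trit x → Trit y → Pairing (x ℚ.+ y)
Trit+Trit (trit-1 refl) (trit-1 refl) = pair-2 refl
Trit+Trit (trit-1 refl) (trit0 refl)  = pair-1 refl
Trit+Trit (trit-1 refl) (trit1 refl)  = pair0 refl
Trit+Trit (trit0 refl)  (trit-1 refl) = pair-1 refl
Trit+Trit (trit0 refl)  (trit0 refl)  = pair0 refl
Trit+Trit (trit0 refl)  (trit1 refl)  = pair1 refl
Trit+Trit (trit1 refl)  (trit-1 refl) = pair0 refl
Trit+Trit (trit1 refl)  (trit0 refl)  = pair1 refl
Trit+Trit (trit1 refl)  (trit1 refl)  = pair2 refl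

sgn+sgn≢-1 : ∀ s t → sgn s ℚ.+ sgn t ≢ ℚ.- 1ℚ
sgn+sgn≢-1 Sign.+ Sign.+ ()
sgn+sgn≢-1 Sign.+ Sign.- ()
sgn+sgn≢-1 Sign.- Sign.+ ()
sgn+sgn≢-1 Sign.- Sign.- ()

DR : ∀ {m} → Sign → Sign → Fin m → Fin m → V m
DR s t i j = (sgn s · e i) ⊕ (sgn t · e j)

DR-swap : ∀ {m} s t (i j : Fin m) → DR s t i j ≡ DR t s j i
DR-swap s t i j = ⊕-comm (sgn s · e i) (sgn t · e j)

B-DR : ∀ {m} s t (i j : Fin m) v → B (DR s t i j) v ≡ sgn s ℚ.* lookup v i ℚ.+ sgn t ℚ.* lookup v j
B-DR s t i j v = trans (B-⊕ˡ (sgn s · e i) (sgn t · e j) v)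
  (cong₂ ℚ._+_ (trans (B-·ˡ (sgn s) (e i) v) (cong (sgn s ℚ.*_) (B-e i v)))
               (trans (B-·ˡ (sgn t) (e j) v) (cong (sgn t ℚ.*_) (B-e j v))))

lookup-DR : ∀ {m} s t (i j z : Fin m) → lookup (DR s t i j) z ≡ sgn s ℚ.* δ i 1ℚ z ℚ.+ sgn t ℚ.* δ j 1ℚ z
lookup-DR s t i j z = trans (Vecₚ.lookup-zipWith ℚ._+_ z (sgn s · e i) (sgn t · e j))
  (cong₂ ℚ._+_ (trans (Vecₚ.lookup-map z (sgn s ℚ.*_) (e i)) (cong (sgn s ℚ.*_) (lookup-e i z)))
               (trans (Vecₚ.lookup-map z (sgn t ℚ.*_) (e j)) (cong (sgn t ℚ.*_) (lookup-e j z))))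

lookup-DR-first : ∀ {m} s t (i j : Fin m) → i ≢ j → lookup (DR s t i j) i ≡ sgn s
lookup-DR-first s t i j i≢j = begin
  lookup (DR s t i j) i
    ≡⟨ lookup-DR s t i j i ⟩
  sgn s ℚ.* δ i 1ℚ i ℚ.+ sgn t ℚ.* δ j 1ℚ i
    ≡⟨ cong₂ (λ a b → sgn s ℚ.* a ℚ.+ sgn t ℚ.* b) (δ-same i 1ℚ) (δ-other j i 1ℚ i≢j) ⟩
  sgn s ℚ.* 1ℚ ℚ.+ sgn t ℚ.* 0ℚ
    ≡⟨ solve 2 (λ a b → a :* con 1ℚ :+ b :* con 0ℚ := a) refl (sgn s) (sgn t) ⟩
  sgn s ∎

lookup-DR-second : ∀ {m} s t (i j : Fin m) → i ≢ j → lookup (DR s t i j) j ≡ sgn t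
lookup-DR-second s t i j i≢j = trans (cong (λ v → lookup v j) (DR-swap s t i j)) (lookup-DR-first t s j i (i≢j ∘ sym))

lookup-DR-other : ∀ {m} s t (i j z : Fin m) → z ≢ i → z ≢ j → lookup (DR s t i j) z ≡ 0ℚ
lookup-DR-other s t i j z z≢i z≢j = begin
  lookup (DR s t i j) z
    ≡⟨ lookup-DR s t i j z ⟩
  sgn s ℚ.* δ i 1ℚ z ℚ.+ sgn t ℚ.* δ j 1ℚ z
    ≡⟨ cong₂ (λ a b → sgn s ℚ.* a ℚ.+ sgn t ℚ.* b) (δ-other i z 1ℚ z≢i) (δ-other j z 1ℚ z≢j) ⟩
  sgn s ℚ.* 0ℚ ℚ.+ sgn t ℚ.* 0ℚ
    ≡⟨ solve 2 (λ a b → a :* con 0ℚ :+ b :* con 0ℚ := con 0ℚ) refl (sgn s) (sgn t) ⟩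
  0ℚ ∎

Trit-lookup-DR : ∀ {m} s t (i j : Fin m) → i ≢ j → ∀ z → Trit (lookup (DR s t i j) z)
Trit-lookup-DR s t i j i≢j z with z Finₚ.≟ i | z Finₚ.≟ j
... | yes refl | _        = subst Trit (sym (lookup-DR-first s t z j i≢j)) (Trit-sgn s)
... | no _     | yes refl = subst Trit (sym (lookup-DR-second s t i z i≢j)) (Trit-sgn t)
... | no z≢i   | no z≢j   = trit0 (lookup-DR-other s t i j z z≢i z≢j)

DR-cancel : ∀ {m} s t t' (i j l : Fin m) → DR s t i j ⊕ DR (opposite s) t' i l ≡ DR t t' j l
DR-cancel s t t' i j l = begin
  (sgn s · e i ⊕ sgn t · e j) ⊕ (sgn (opposite s) · e i ⊕ sgn t' · e l)
    ≡⟨ ⊕-interchange _ _ _ _ ⟩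
  (sgn s · e i ⊕ sgn (opposite s) · e i) ⊕ DR t t' j l
    ≡⟨ cong (_⊕ DR t t' j l) (sym (·-distribʳ-+ (sgn s) (sgn (opposite s)) (e i))) ⟩
  (sgn s ℚ.+ sgn (opposite s)) · e i ⊕ DR t t' j l
    ≡⟨ cong (λ c → c · e i ⊕ DR t t' j l) (sgn+sgn-opposite s) ⟩
  0ℚ · e i ⊕ DR t t' j l
    ≡⟨ cong (_⊕ DR t t' j l) (·-zeroˡ (e i)) ⟩
  𝟘 ⊕ DR t t' j l
    ≡⟨ ⊕-identityˡ _ ⟩
  DR t t' j l ∎

DRoot-norm : ∀ {m} {α : V m} → DRoot α → B α α ≡ 2ℚ
DRoot-norm (i , j , i≢j , s , t , refl) = begin
  B (DR s t i j) (DR s t i j)                                   ≡⟨ B-DR s t i j _ ⟩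
  sgn s ℚ.* lookup (DR s t i j) i ℚ.+ sgn t ℚ.* lookup (DR s t i j) j
    ≡⟨ cong₂ (λ a b → sgn s ℚ.* a ℚ.+ sgn t ℚ.* b) (lookup-DR-first s t i j i≢j) (lookup-DR-second s t i j i≢j) ⟩
  sgn s ℚ.* sgn s ℚ.+ sgn t ℚ.* sgn t                           ≡⟨ square-sum s t ⟩
  2ℚ                                                            ∎
  where
  square-sum : ∀ s t → sgn s ℚ.* sgn s ℚ.+ sgn t ℚ.* sgn t ≡ 2ℚ
  square-sum Sign.+ Sign.+ = refl
  square-sum Sign.+ Sign.- = refl
  square-sum Sign.- Sign.+ = refl
  square-sum Sign.- Sign.- = refl

B-DR-Trits : ∀ {m} s t (i j : Fin m) {v} → Trit (lookup v i) → Trit (lookup v j) → Pairing (B (DR s t i j) v)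
B-DR-Trits s t i j {v} tᵢ tⱼ = subst Pairing (sym (B-DR s t i j v)) (Trit+Trit (Trit-sgn* s tᵢ) (Trit-sgn* t tⱼ))

DRoot-pairing : ∀ {m} {α β : V m} → DRoot α → DRoot β → Pairing (B α β)
DRoot-pairing (i , j , _ , s , t , refl) (k , l , k≢l , s' , t' , refl) =
  B-DR-Trits s t i j (Trit-lookup-DR s' t' k l k≢l i) (Trit-lookup-DR s' t' k l k≢l j)

DRoot-neg : ∀ {m} {α : V m} → DRoot α → DRoot (neg α)
DRoot-neg (i , j , i≢j , s , t , refl) = i , j , i≢j , opposite s , opposite t ,
  trans (neg-distrib-⊕ (sgn s · e i) (sgn t · e j))
        (cong₂ _⊕_ (trans (neg-· (sgn s) (e i)) (cong (_· e i) (sgn-opposite s)))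
                   (trans (neg-· (sgn t) (e j)) (cong (_· e j) (sgn-opposite t))))

sgn≡-1⇒- : ∀ s → sgn s ≡ ℚ.- 1ℚ → s ≡ Sign.-
sgn≡-1⇒- Sign.- _ = refl

DRoot-sum-shared : ∀ {m} s t s' t' (i j l : Fin m) → i ≢ j → i ≢ l →
                   B (DR s t i j) (DR s' t' i l) ≡ ℚ.- 1ℚ → DRoot (DR s t i j ⊕ DR s' t' i l)
DRoot-sum-shared s t s' t' i j l i≢j i≢l B≡-1 with j Finₚ.≟ l
... | yes refl = ⊥-elim (sgn+sgn≢-1 (s Sign.* s') (t Sign.* t') (begin
  sgn (s Sign.* s') ℚ.+ sgn (t Sign.* t')
    ≡⟨ sym (cong₂ ℚ._+_ (sgn-* s s') (sgn-* t t')) ⟩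
  sgn s ℚ.* sgn s' ℚ.+ sgn t ℚ.* sgn t'
    ≡⟨ sym (cong₂ (λ a b → sgn s ℚ.* a ℚ.+ sgn t ℚ.* b) (lookup-DR-first s' t' i j i≢j) (lookup-DR-second s' t' i j i≢j)) ⟩
  sgn s ℚ.* lookup (DR s' t' i j) i ℚ.+ sgn t ℚ.* lookup (DR s' t' i j) j
    ≡⟨ sym (B-DR s t i j _) ⟩
  B (DR s t i j) (DR s' t' i j)
    ≡⟨ B≡-1 ⟩
  ℚ.- 1ℚ ∎))
... | no j≢l = j , l , j≢l , t , t' , subst (λ s' → DR s t i j ⊕ DR s' t' i l ≡ DR t t' j l) (sym s'≡) (DR-cancel s t t' i j l)
  where
  s'≡ : s' ≡ opposite s
  s'≡ = s*t≡-⇒t≡opposite s s' (sgn≡-1⇒- (s Sign.* s') (begin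
    sgn (s Sign.* s')
      ≡⟨ sym (sgn-* s s') ⟩
    sgn s ℚ.* sgn s'
      ≡⟨ solve 2 (λ a b → a := a :+ b :* con 0ℚ) refl (sgn s ℚ.* sgn s') (sgn t) ⟩
    sgn s ℚ.* sgn s' ℚ.+ sgn t ℚ.* 0ℚ
      ≡⟨ sym (cong₂ (λ a b → sgn s ℚ.* a ℚ.+ sgn t ℚ.* b) (lookup-DR-first s' t' i l i≢l) (lookup-DR-other s' t' i l j (i≢j ∘ sym) j≢l)) ⟩
    sgn s ℚ.* lookup (DR s' t' i l) i ℚ.+ sgn t ℚ.* lookup (DR s' t' i l) j
      ≡⟨ sym (B-DR s t i j _) ⟩
    B (DR s t i j) (DR s' t' i l)
      ≡⟨ B≡-1 ⟩
    ℚ.- 1ℚ ∎))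

-- Up to swapping the two terms of α or of β, a pairing of -1 forces a shared first index.
DRoot-sum : ∀ {m} {α β : V m} → DRoot α → DRoot β → B α β ≡ ℚ.- 1ℚ → DRoot (α ⊕ β)
DRoot-sum (i , j , i≢j , s , t , refl) (k , l , k≢l , s' , t' , refl) B≡-1
  with i Finₚ.≟ k | i Finₚ.≟ l | j Finₚ.≟ k | j Finₚ.≟ l
... | yes refl | _ | _ | _ = DRoot-sum-shared s t s' t' i j l i≢j k≢l B≡-1
... | no _ | yes refl | _ | _ =
  subst (λ β → DRoot (DR s t i j ⊕ β)) (sym (DR-swap s' t' k i))
        (DRoot-sum-shared s t t' s' i j k i≢j (k≢l ∘ sym) (trans (cong (B (DR s t i j)) (sym (DR-swap s' t' k i))) B≡-1))
... | no _ | no _ | yes refl | _ =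
  subst (λ α → DRoot (α ⊕ DR s' t' j l)) (sym (DR-swap s t i j))
        (DRoot-sum-shared t s s' t' j i l (i≢j ∘ sym) k≢l (trans (cong (λ α → B α (DR s' t' j l)) (sym (DR-swap s t i j))) B≡-1))
... | no _ | no _ | no _ | yes refl =
  subst₂ (λ α β → DRoot (α ⊕ β)) (sym (DR-swap s t i j)) (sym (DR-swap s' t' k j))
         (DRoot-sum-shared t s t' s' j i k (i≢j ∘ sym) (k≢l ∘ sym)
            (trans (cong₂ B (sym (DR-swap s t i j)) (sym (DR-swap s' t' k j))) B≡-1))
... | no i≢k | no i≢l | no j≢k | no j≢l = ⊥-elim (case trans (sym B≡-1) (begin
  B (DR s t i j) (DR s' t' k l)
    ≡⟨ B-DR s t i j _ ⟩
  sgn s ℚ.* lookup (DR s' t' k l) i ℚ.+ sgn t ℚ.* lookup (DR s' t' k l) j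
    ≡⟨ cong₂ (λ a b → sgn s ℚ.* a ℚ.+ sgn t ℚ.* b) (lookup-DR-other s' t' k l i i≢k i≢l) (lookup-DR-other s' t' k l j j≢k j≢l) ⟩
  sgn s ℚ.* 0ℚ ℚ.+ sgn t ℚ.* 0ℚ
    ≡⟨ solve 2 (λ a b → a :* con 0ℚ :+ b :* con 0ℚ := con 0ℚ) refl (sgn s) (sgn t) ⟩
  0ℚ ∎) of λ ())

minusCount-≤ : ∀ {m} (a : Fin m → Sign) → minusCount a ℕ.≤ m
minusCount-≤ {zero}  a = ℕ.z≤n
minusCount-≤ {suc m} a with a zero
... | Sign.- = s≤s (minusCount-≤ (a ∘ suc))
... | Sign.+ = ℕₚ.m≤n⇒m≤1+n (minusCount-≤ (a ∘ suc))

minusCount-* : ∀ {m} (a b : Fin m → Sign) →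
               Σ ℕ λ k → minusCount a ℕ.+ minusCount b ≡ minusCount (λ z → a z Sign.* b z) ℕ.+ 2 ℕ.* k
minusCount-* {zero}  a b = 0 , refl
minusCount-* {suc m} a b with a zero | b zero | minusCount-* (a ∘ suc) (b ∘ suc)
... | Sign.+ | Sign.+ | k , eq = k , eq
... | Sign.+ | Sign.- | k , eq = k , trans (ℕₚ.+-suc _ _) (cong suc eq)
... | Sign.- | Sign.+ | k , eq = k , cong suc eq
... | Sign.- | Sign.- | k , eq = suc k , (begin
  suc (minusCount (a ∘ suc) ℕ.+ suc (minusCount (b ∘ suc)))      ≡⟨ cong suc (ℕₚ.+-suc _ _) ⟩
  suc (suc (minusCount (a ∘ suc) ℕ.+ minusCount (b ∘ suc)))      ≡⟨ cong (λ x → ℕ.suc (ℕ.suc x)) eq ⟩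
  suc (suc (c ℕ.+ 2 ℕ.* k))                                      ≡⟨ cong suc (ℕₚ.+-suc c _) ⟨
  suc (c ℕ.+ suc (2 ℕ.* k))                                      ≡⟨ ℕₚ.+-suc c _ ⟨
  c ℕ.+ suc (suc (2 ℕ.* k))                                      ≡⟨ cong (c ℕ.+_) (ℕₚ.*-suc 2 k) ⟨
  c ℕ.+ 2 ℕ.* suc k                                              ∎)
  where
  c = minusCount (λ z → a (suc z) Sign.* b (suc z))

Even : ∀ {m} → (Fin m → Sign) → Set
Even ε = 2 ∣ minusCount ε

even-* : ∀ {m} (a b : Fin m → Sign) → Even a → Even b → Even (λ z → a z Sign.* b z)
even-* a b 2∣a 2∣b with minusCount-* a b
... | k , eq = ∣m+n∣m⇒∣n (subst (2 ∣_) (trans eq (ℕₚ.+-comm _ (2 ℕ.* k))) (∣m∣n⇒∣m+n 2∣a 2∣b)) (m∣m*n k)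

minusCount-none : ∀ {m} (a : Fin m → Sign) → (∀ z → a z ≡ Sign.+) → minusCount a ≡ 0
minusCount-none {zero}  a _   = refl
minusCount-none {suc m} a a≡+ with a zero | a≡+ zero
... | Sign.+ | refl = minusCount-none (a ∘ suc) (a≡+ ∘ suc)

minusCount-one : ∀ {m} (a : Fin m → Sign) i → a i ≡ Sign.- → (∀ z → z ≢ i → a z ≡ Sign.+) → minusCount a ≡ 1
minusCount-one {suc m} a zero aᵢ≡- a≡+ with a zero | aᵢ≡-
... | Sign.- | refl = cong suc (minusCount-none (a ∘ suc) (λ z → a≡+ (suc z) λ ()))
minusCount-one {suc m} a (suc i) aᵢ≡- a≡+ with a zero | a≡+ zero (λ ())
... | Sign.+ | refl = minusCount-one (a ∘ suc) i aᵢ≡- (λ z z≢i → a≡+ (suc z) (z≢i ∘ Finₚ.suc-injective))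

minusCount-two : ∀ {m} (a : Fin m → Sign) i j → i ≢ j → a i ≡ Sign.- → a j ≡ Sign.- →
                 (∀ z → z ≢ i → z ≢ j → a z ≡ Sign.+) → minusCount a ≡ 2
minusCount-two {suc m} a zero    zero    i≢j _ _ _ = ⊥-elim (i≢j refl)
minusCount-two {suc m} a zero    (suc j) _ aᵢ≡- aⱼ≡- a≡+ with a zero | aᵢ≡-
... | Sign.- | refl = cong suc (minusCount-one (a ∘ suc) j aⱼ≡- (λ z z≢j → a≡+ (suc z) (λ ()) (z≢j ∘ Finₚ.suc-injective)))
minusCount-two {suc m} a (suc i) zero    _ aᵢ≡- aⱼ≡- a≡+ with a zero | aⱼ≡-
... | Sign.- | refl = cong suc (minusCount-one (a ∘ suc) i aᵢ≡- (λ z z≢i → a≡+ (suc z) (z≢i ∘ Finₚ.suc-injective) (λ ())))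
minusCount-two {suc m} a (suc i) (suc j) i≢j aᵢ≡- aⱼ≡- a≡+ with a zero | a≡+ zero (λ ()) (λ ())
... | Sign.+ | refl = minusCount-two (a ∘ suc) i j (i≢j ∘ cong suc) aᵢ≡- aⱼ≡-
                        (λ z z≢i z≢j → a≡+ (suc z) (z≢i ∘ Finₚ.suc-injective) (z≢j ∘ Finₚ.suc-injective))

minusCount≡m⇒all- : ∀ {m} (a : Fin m → Sign) → minusCount a ≡ m → ∀ z → a z ≡ Sign.-
minusCount≡m⇒all- {suc m} a eq z with a zero in a₀≡
minusCount≡m⇒all- {suc m} a eq zero    | Sign.- = a₀≡
minusCount≡m⇒all- {suc m} a eq (suc z) | Sign.- = minusCount≡m⇒all- (a ∘ suc) (ℕₚ.suc-injective eq) z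
minusCount≡m⇒all- {suc m} a eq z       | Sign.+ = ⊥-elim (ℕₚ.<-irrefl refl (subst (ℕ._≤ m) eq (minusCount-≤ (a ∘ suc))))

one-plus : ∀ {m} (a : Fin m → Sign) → suc (minusCount a) ≡ m →
           Σ (Fin m) λ i → a i ≡ Sign.+ × (∀ z → z ≢ i → a z ≡ Sign.-)
one-plus {suc m} a eq with a zero in a₀≡
... | Sign.+ = zero , a₀≡ , λ { zero z≢0 → ⊥-elim (z≢0 refl) ; (suc z) _ → minusCount≡m⇒all- (a ∘ suc) (ℕₚ.suc-injective eq) z }
... | Sign.- with one-plus (a ∘ suc) (ℕₚ.suc-injective eq)
...   | i , aᵢ≡+ , rest = suc i , aᵢ≡+ , λ { zero _ → a₀≡ ; (suc z) z≢i → rest z (z≢i ∘ cong suc) }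

two-plus : ∀ {m} (a : Fin m → Sign) → suc (suc (minusCount a)) ≡ m →
           Σ (Fin m) λ i → Σ (Fin m) λ j → i ≢ j × a i ≡ Sign.+ × a j ≡ Sign.+ ×
             (∀ z → z ≢ i → z ≢ j → a z ≡ Sign.-)
two-plus {suc m} a eq with a zero in a₀≡
... | Sign.+ with one-plus (a ∘ suc) (ℕₚ.suc-injective eq)
...   | j , aⱼ≡+ , rest = zero , suc j , (λ ()) , a₀≡ , aⱼ≡+ ,
        λ { zero z≢0 _ → ⊥-elim (z≢0 refl) ; (suc z) _ z≢j → rest z (z≢j ∘ cong suc) }
two-plus {suc m} a eq | Sign.- with two-plus (a ∘ suc) (ℕₚ.suc-injective eq)
...   | i , j , i≢j , aᵢ≡+ , aⱼ≡+ , rest = suc i , suc j , i≢j ∘ Finₚ.suc-injective , aᵢ≡+ , aⱼ≡+ ,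
        λ { zero _ _ → a₀≡ ; (suc z) z≢i z≢j → rest z (z≢i ∘ cong suc) (z≢j ∘ cong suc) }

-- The root systems E₈ and E₇

¼ : ℚ
¼ = ½ ℚ.* ½

lookup-halfSigns : ∀ {m} (ε : Fin m → Sign) z → lookup (halfSigns ε) z ≡ ½ ℚ.* sgn (ε z)
lookup-halfSigns ε = lookup-lincomb-e (λ i → ½ ℚ.* sgn (ε i))

B-halfSigns : ∀ {m} (ε ε' : Fin m → Sign) → B (halfSigns ε) (halfSigns ε') ≡ sum (λ z → ¼ ℚ.* sgn (ε z Sign.* ε' z))
B-halfSigns ε ε' = trans (B-as-sum (halfSigns ε) (halfSigns ε'))
  (sum-cong-≗ λ z → trans (cong₂ ℚ._*_ (lookup-halfSigns ε z) (lookup-halfSigns ε' z)) (half*half (ε z) (ε' z)))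
  where
  half*half : ∀ a b → (½ ℚ.* sgn a) ℚ.* (½ ℚ.* sgn b) ≡ ¼ ℚ.* sgn (a Sign.* b)
  half*half Sign.+ Sign.+ = refl
  half*half Sign.+ Sign.- = refl
  half*half Sign.- Sign.+ = refl
  half*half Sign.- Sign.- = refl

sum-¼sgn : ∀ {m} (a : Fin m → Sign) → sum (λ z → ¼ ℚ.* sgn (a z)) ≡ ¼ ℚ.* fromℕ m ℚ.- ½ ℚ.* fromℕ (minusCount a)
sum-¼sgn {zero}  a = refl
sum-¼sgn {suc m} a with a zero
... | Sign.+ = trans (cong (¼ ℚ.* 1ℚ ℚ.+_) (sum-¼sgn (a ∘ suc)))
  (solve 2 (λ x y → con ¼ :* con 1ℚ :+ (con ¼ :* x :- con ½ :* y) := con ¼ :* (con 1ℚ :+ x) :- con ½ :* y)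
     refl (fromℕ m) (fromℕ (minusCount (a ∘ suc))))
... | Sign.- = trans (cong (¼ ℚ.* ℚ.- 1ℚ ℚ.+_) (sum-¼sgn (a ∘ suc)))
  (solve 2 (λ x y → con ¼ :* con (ℚ.- 1ℚ) :+ (con ¼ :* x :- con ½ :* y) := con ¼ :* (con 1ℚ :+ x) :- con ½ :* (con 1ℚ :+ y))
     refl (fromℕ m) (fromℕ (minusCount (a ∘ suc))))

-- On the half-integral roots, B counts the coordinates q where the signs disagree: B = 2 - q/2.
B-halfSigns-count : ∀ (ε ε' : Fin 8 → Sign) →
                    B (halfSigns ε) (halfSigns ε') ≡ 2ℚ ℚ.- ½ ℚ.* fromℕ (minusCount (λ z → ε z Sign.* ε' z))
B-halfSigns-count ε ε' = trans (B-halfSigns ε ε') (sum-¼sgn (λ z → ε z Sign.* ε' z))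

halfSigns-norm : ∀ (ε : Fin 8 → Sign) → B (halfSigns ε) (halfSigns ε) ≡ 2ℚ
halfSigns-norm ε = trans (B-halfSigns-count ε ε)
  (cong (λ k → 2ℚ ℚ.- ½ ℚ.* fromℕ k) (minusCount-none _ (s*s≡+ ∘ ε)))
  where
  s*s≡+ : ∀ s → s Sign.* s ≡ Sign.+
  s*s≡+ Sign.+ = refl
  s*s≡+ Sign.- = refl

pairing-of-disagreements : ∀ q → q ℕ.* 2 ℕ.≤ 8 → Pairing (2ℚ ℚ.- ½ ℚ.* fromℕ (q ℕ.* 2))
pairing-of-disagreements 0 _ = pair2 refl
pairing-of-disagreements 1 _ = pair1 refl
pairing-of-disagreements 2 _ = pair0 refl
pairing-of-disagreements 3 _ = pair-1 refl
pairing-of-disagreements 4 _ = pair-2 refl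
pairing-of-disagreements (suc (suc (suc (suc (suc q))))) (s≤s (s≤s (s≤s (s≤s (s≤s (s≤s (s≤s (s≤s ()))))))))

B-halfSigns-even : ∀ (ε ε' : Fin 8 → Sign) → Even ε → Even ε' →
  Σ ℕ λ q → minusCount (λ z → ε z Sign.* ε' z) ≡ q ℕ.* 2 × q ℕ.* 2 ℕ.≤ 8 ×
            B (halfSigns ε) (halfSigns ε') ≡ 2ℚ ℚ.- ½ ℚ.* fromℕ (q ℕ.* 2)
B-halfSigns-even ε ε' ε-even ε'-even with even-* ε ε' ε-even ε'-even
... | divides q eq = q , eq , subst (ℕ._≤ 8) eq (minusCount-≤ (λ z → ε z Sign.* ε' z)) ,
                     trans (B-halfSigns-count ε ε') (cong (λ k → 2ℚ ℚ.- ½ ℚ.* fromℕ k) eq)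

halfSigns-pairing : ∀ (ε ε' : Fin 8 → Sign) → Even ε → Even ε' → Pairing (B (halfSigns ε) (halfSigns ε'))
halfSigns-pairing ε ε' ε-even ε'-even =
  let (q , _ , q≤4 , B≡) = B-halfSigns-even ε ε' ε-even ε'-even in subst Pairing (sym B≡) (pairing-of-disagreements q q≤4)

½sgn+½sgn : ∀ s → ½ ℚ.* sgn s ℚ.+ ½ ℚ.* sgn s ≡ sgn s
½sgn+½sgn Sign.+ = refl
½sgn+½sgn Sign.- = refl

½sgn+½sgn-opposite : ∀ s → ½ ℚ.* sgn s ℚ.+ ½ ℚ.* sgn (opposite s) ≡ 0ℚ
½sgn+½sgn-opposite Sign.+ = refl
½sgn+½sgn-opposite Sign.- = refl

s*t≡+⇒t≡s : ∀ s t → s Sign.* t ≡ Sign.+ → t ≡ s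
s*t≡+⇒t≡s Sign.+ Sign.+ _ = refl
s*t≡+⇒t≡s Sign.- Sign.- _ = refl

halfSigns-agreeing-twice : ∀ {m} (ε ε' : Fin m → Sign) i j → i ≢ j →
  ε i Sign.* ε' i ≡ Sign.+ → ε j Sign.* ε' j ≡ Sign.+ → (∀ z → z ≢ i → z ≢ j → ε z Sign.* ε' z ≡ Sign.-) →
  halfSigns ε ⊕ halfSigns ε' ≡ DR (ε i) (ε j) i j
halfSigns-agreeing-twice ε ε' i j i≢j agreeᵢ agreeⱼ disagree = ≗-lookup⇒≡ _ _ λ z →
  trans (Vecₚ.lookup-zipWith ℚ._+_ z (halfSigns ε) (halfSigns ε'))
        (trans (cong₂ ℚ._+_ (lookup-halfSigns ε z) (lookup-halfSigns ε' z)) (coordinate z))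
  where
  coordinate : ∀ z → ½ ℚ.* sgn (ε z) ℚ.+ ½ ℚ.* sgn (ε' z) ≡ lookup (DR (ε i) (ε j) i j) z
  coordinate z with z Finₚ.≟ i | z Finₚ.≟ j
  ... | yes refl | _ = begin
    ½ ℚ.* sgn (ε z) ℚ.+ ½ ℚ.* sgn (ε' z)
      ≡⟨ cong (λ s → ½ ℚ.* sgn (ε z) ℚ.+ ½ ℚ.* sgn s) (s*t≡+⇒t≡s (ε z) (ε' z) agreeᵢ) ⟩
    ½ ℚ.* sgn (ε z) ℚ.+ ½ ℚ.* sgn (ε z)
      ≡⟨ ½sgn+½sgn (ε z) ⟩
    sgn (ε z)
      ≡⟨ lookup-DR-first (ε z) (ε j) z j i≢j ⟨
    lookup (DR (ε z) (ε j) z j) z ∎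
  ... | no _ | yes refl = begin
    ½ ℚ.* sgn (ε z) ℚ.+ ½ ℚ.* sgn (ε' z)
      ≡⟨ cong (λ s → ½ ℚ.* sgn (ε z) ℚ.+ ½ ℚ.* sgn s) (s*t≡+⇒t≡s (ε z) (ε' z) agreeⱼ) ⟩
    ½ ℚ.* sgn (ε z) ℚ.+ ½ ℚ.* sgn (ε z)
      ≡⟨ ½sgn+½sgn (ε z) ⟩
    sgn (ε z)
      ≡⟨ lookup-DR-second (ε i) (ε z) i z i≢j ⟨
    lookup (DR (ε i) (ε z) i z) z ∎
  ... | no z≢i | no z≢j = begin
    ½ ℚ.* sgn (ε z) ℚ.+ ½ ℚ.* sgn (ε' z)
      ≡⟨ cong (λ s → ½ ℚ.* sgn (ε z) ℚ.+ ½ ℚ.* sgn s) (s*t≡-⇒t≡opposite (ε z) (ε' z) (disagree z z≢i z≢j)) ⟩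
    ½ ℚ.* sgn (ε z) ℚ.+ ½ ℚ.* sgn (opposite (ε z))
      ≡⟨ ½sgn+½sgn-opposite (ε z) ⟩
    0ℚ
      ≡⟨ lookup-DR-other (ε i) (ε j) i j z z≢i z≢j ⟨
    lookup (DR (ε i) (ε j) i j) z ∎

-- A pairing of -1 means that the signs disagree in exactly six coordinates.
halfSigns-sum : ∀ (ε ε' : Fin 8 → Sign) → Even ε → Even ε' → B (halfSigns ε) (halfSigns ε') ≡ ℚ.- 1ℚ →
                DRoot (halfSigns ε ⊕ halfSigns ε')
halfSigns-sum ε ε' ε-even ε'-even B≡-1 = from-agreement (two-plus (λ z → ε z Sign.* ε' z) (six-disagreements q d≡2q q≤4 B≡))
  where
  counted = B-halfSigns-even ε ε' ε-even ε'-even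
  q = proj₁ counted
  d≡2q = proj₁ (proj₂ counted)
  q≤4 = proj₁ (proj₂ (proj₂ counted))
  B≡ = proj₂ (proj₂ (proj₂ counted))
  six-disagreements : ∀ q → minusCount (λ z → ε z Sign.* ε' z) ≡ q ℕ.* 2 → q ℕ.* 2 ℕ.≤ 8 →
    B (halfSigns ε) (halfSigns ε') ≡ 2ℚ ℚ.- ½ ℚ.* fromℕ (q ℕ.* 2) → suc (suc (minusCount (λ z → ε z Sign.* ε' z))) ≡ 8
  six-disagreements 3 d≡6 _ _  = cong (λ k → ℕ.suc (ℕ.suc k)) d≡6
  six-disagreements 0 _   _ B≡ = case trans (sym B≡-1) B≡ of λ ()
  six-disagreements 1 _   _ B≡ = case trans (sym B≡-1) B≡ of λ ()
  six-disagreements 2 _   _ B≡ = case trans (sym B≡-1) B≡ of λ ()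
  six-disagreements 4 _   _ B≡ = case trans (sym B≡-1) B≡ of λ ()
  six-disagreements (suc (suc (suc (suc (suc q))))) _ (s≤s (s≤s (s≤s (s≤s (s≤s (s≤s (s≤s (s≤s ())))))))) _
  from-agreement : (Σ (Fin 8) λ i → Σ (Fin 8) λ j → i ≢ j × ε i Sign.* ε' i ≡ Sign.+ × ε j Sign.* ε' j ≡ Sign.+ ×
                     (∀ z → z ≢ i → z ≢ j → ε z Sign.* ε' z ≡ Sign.-)) → DRoot (halfSigns ε ⊕ halfSigns ε')
  from-agreement (i , j , i≢j , agreeᵢ , agreeⱼ , disagree) =
    i , j , i≢j , ε i , ε j , halfSigns-agreeing-twice ε ε' i j i≢j agreeᵢ agreeⱼ disagree

sgn*½sgn : ∀ s a → sgn s ℚ.* (½ ℚ.* sgn a) ≡ ½ ℚ.* sgn (s Sign.* a)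
sgn*½sgn Sign.+ Sign.+ = refl
sgn*½sgn Sign.+ Sign.- = refl
sgn*½sgn Sign.- Sign.+ = refl
sgn*½sgn Sign.- Sign.- = refl

½sgn+½sgn-pairing : ∀ u v → Pairing (½ ℚ.* sgn u ℚ.+ ½ ℚ.* sgn v)
½sgn+½sgn-pairing Sign.+ Sign.+ = pair1 refl
½sgn+½sgn-pairing Sign.+ Sign.- = pair0 refl
½sgn+½sgn-pairing Sign.- Sign.+ = pair0 refl
½sgn+½sgn-pairing Sign.- Sign.- = pair-1 refl

½sgn+½sgn≡-1 : ∀ u v → ½ ℚ.* sgn u ℚ.+ ½ ℚ.* sgn v ≡ ℚ.- 1ℚ → u ≡ Sign.- × v ≡ Sign.-
½sgn+½sgn≡-1 Sign.- Sign.- _ = refl , refl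
½sgn+½sgn≡-1 Sign.+ Sign.+ ()
½sgn+½sgn≡-1 Sign.+ Sign.- ()
½sgn+½sgn≡-1 Sign.- Sign.+ ()

B-DR-halfSigns : ∀ {m} s t (i j : Fin m) ε →
                 B (DR s t i j) (halfSigns ε) ≡ ½ ℚ.* sgn (s Sign.* ε i) ℚ.+ ½ ℚ.* sgn (t Sign.* ε j)
B-DR-halfSigns s t i j ε = trans (B-DR s t i j (halfSigns ε))
  (cong₂ ℚ._+_ (trans (cong (sgn s ℚ.*_) (lookup-halfSigns ε i)) (sgn*½sgn s (ε i)))
               (trans (cong (sgn t ℚ.*_) (lookup-halfSigns ε j)) (sgn*½sgn t (ε j))))

DR-halfSigns-pairing : ∀ {m} s t (i j : Fin m) ε → Pairing (B (DR s t i j) (halfSigns ε))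
DR-halfSigns-pairing s t i j ε = subst Pairing (sym (B-DR-halfSigns s t i j ε)) (½sgn+½sgn-pairing (s Sign.* ε i) (t Sign.* ε j))

minus-at : ∀ {m} → Fin m → Fin m → Fin m → Sign
minus-at i j z with z Finₚ.≟ i | z Finₚ.≟ j
... | yes _ | _     = Sign.-
... | no _  | yes _ = Sign.-
... | no _  | no _  = Sign.+

minus-at-even : ∀ {m} (i j : Fin m) → i ≢ j → Even (minus-at i j)
minus-at-even i j i≢j = divides 1 (minusCount-two (minus-at i j) i j i≢j at-i at-j elsewhere)
  where
  at-i : minus-at i j i ≡ Sign.-
  at-i with i Finₚ.≟ i
  ... | yes _  = refl
  ... | no i≢i = ⊥-elim (i≢i refl)
  at-j : minus-at i j j ≡ Sign.-
  at-j with j Finₚ.≟ i | j Finₚ.≟ j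
  ... | yes _ | _      = refl
  ... | no _  | yes _  = refl
  ... | no _  | no j≢j = ⊥-elim (j≢j refl)
  elsewhere : ∀ z → z ≢ i → z ≢ j → minus-at i j z ≡ Sign.+
  elsewhere z z≢i z≢j with z Finₚ.≟ i | z Finₚ.≟ j
  ... | yes z≡i | _       = ⊥-elim (z≢i z≡i)
  ... | no _    | yes z≡j = ⊥-elim (z≢j z≡j)
  ... | no _    | no _    = refl

-- Adding ±eᵢ ± eⱼ flips the two opposite signs of a half-integral vector at i and j.
DR⊕halfSigns : ∀ {m} s t (i j : Fin m) → i ≢ j → (ε : Fin m → Sign) → ε i ≡ opposite s → ε j ≡ opposite t →
               DR s t i j ⊕ halfSigns ε ≡ halfSigns (λ z → ε z Sign.* minus-at i j z)
DR⊕halfSigns s t i j i≢j ε εᵢ≡ εⱼ≡ = ≗-lookup⇒≡ _ _ λ z →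
  trans (Vecₚ.lookup-zipWith ℚ._+_ z (DR s t i j) (halfSigns ε))
        (trans (cong (lookup (DR s t i j) z ℚ.+_) (lookup-halfSigns ε z))
               (trans (coordinate z) (sym (lookup-halfSigns (λ z → ε z Sign.* minus-at i j z) z))))
  where
  flip-back : ∀ s → sgn s ℚ.+ ½ ℚ.* sgn (opposite s) ≡ ½ ℚ.* sgn (opposite s Sign.* Sign.-)
  flip-back Sign.+ = refl
  flip-back Sign.- = refl
  coordinate : ∀ z → lookup (DR s t i j) z ℚ.+ ½ ℚ.* sgn (ε z) ≡ ½ ℚ.* sgn (ε z Sign.* minus-at i j z)
  coordinate z with z Finₚ.≟ i | z Finₚ.≟ j
  ... | yes refl | _ = begin
    lookup (DR s t z j) z ℚ.+ ½ ℚ.* sgn (ε z)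
      ≡⟨ cong₂ (λ a b → a ℚ.+ ½ ℚ.* sgn b) (lookup-DR-first s t z j i≢j) εᵢ≡ ⟩
    sgn s ℚ.+ ½ ℚ.* sgn (opposite s)
      ≡⟨ flip-back s ⟩
    ½ ℚ.* sgn (opposite s Sign.* Sign.-)
      ≡⟨ cong (λ b → ½ ℚ.* sgn (b Sign.* Sign.-)) εᵢ≡ ⟨
    ½ ℚ.* sgn (ε z Sign.* Sign.-) ∎
  ... | no _ | yes refl = begin
    lookup (DR s t i z) z ℚ.+ ½ ℚ.* sgn (ε z)
      ≡⟨ cong₂ (λ a b → a ℚ.+ ½ ℚ.* sgn b) (lookup-DR-second s t i z i≢j) εⱼ≡ ⟩
    sgn t ℚ.+ ½ ℚ.* sgn (opposite t)
      ≡⟨ flip-back t ⟩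
    ½ ℚ.* sgn (opposite t Sign.* Sign.-)
      ≡⟨ cong (λ b → ½ ℚ.* sgn (b Sign.* Sign.-)) εⱼ≡ ⟨
    ½ ℚ.* sgn (ε z Sign.* Sign.-) ∎
  ... | no z≢i | no z≢j = begin
    lookup (DR s t i j) z ℚ.+ ½ ℚ.* sgn (ε z)
      ≡⟨ cong (ℚ._+ ½ ℚ.* sgn (ε z)) (lookup-DR-other s t i j z z≢i z≢j) ⟩
    0ℚ ℚ.+ ½ ℚ.* sgn (ε z)
      ≡⟨ ℚₚ.+-identityˡ _ ⟩
    ½ ℚ.* sgn (ε z)
      ≡⟨ cong (λ b → ½ ℚ.* sgn b) (Signₚ.*-identityʳ (ε z)) ⟨
    ½ ℚ.* sgn (ε z Sign.* Sign.+) ∎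

DR-halfSigns-sum : ∀ {m} s t (i j : Fin m) → i ≢ j → (ε : Fin m → Sign) → Even ε →
  B (DR s t i j) (halfSigns ε) ≡ ℚ.- 1ℚ → Σ (Fin m → Sign) λ ε' → Even ε' × DR s t i j ⊕ halfSigns ε ≡ halfSigns ε'
DR-halfSigns-sum s t i j i≢j ε ε-even B≡-1 =
  (λ z → ε z Sign.* minus-at i j z) , even-* ε (minus-at i j) ε-even (minus-at-even i j i≢j) ,
  DR⊕halfSigns s t i j i≢j ε (s*t≡-⇒t≡opposite s (ε i) (proj₁ both-minus)) (s*t≡-⇒t≡opposite t (ε j) (proj₂ both-minus))
  where
  both-minus = ½sgn+½sgn≡-1 (s Sign.* ε i) (t Sign.* ε j) (trans (sym (B-DR-halfSigns s t i j ε)) B≡-1)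

halfSigns-neg : ∀ {m} (ε : Fin m → Sign) → neg (halfSigns ε) ≡ halfSigns (λ z → ε z Sign.* Sign.-)
halfSigns-neg ε = ≗-lookup⇒≡ _ _ λ z → begin
  lookup (neg (halfSigns ε)) z                   ≡⟨ Vecₚ.lookup-map z ℚ.-_ (halfSigns ε) ⟩
  ℚ.- lookup (halfSigns ε) z                     ≡⟨ cong ℚ.-_ (lookup-halfSigns ε z) ⟩
  ℚ.- (½ ℚ.* sgn (ε z))                          ≡⟨ negate (ε z) ⟩
  ½ ℚ.* sgn (ε z Sign.* Sign.-)                  ≡⟨ lookup-halfSigns (λ z → ε z Sign.* Sign.-) z ⟨
  lookup (halfSigns (λ z → ε z Sign.* Sign.-)) z ∎
  where
  negate : ∀ s → ℚ.- (½ ℚ.* sgn s) ≡ ½ ℚ.* sgn (s Sign.* Sign.-)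
  negate Sign.+ = refl
  negate Sign.- = refl

DRoot-isSimplyLaced : ∀ {m} → IsSimplyLacedRoots (DRoot {m})
DRoot-isSimplyLaced = record
  { norm = DRoot-norm ; pairing = DRoot-pairing ; neg-closed = DRoot-neg ; sum-closed = DRoot-sum }

E8-norm : ∀ {α} → E8Root α → B α α ≡ 2ℚ
E8-norm (inj₁ α∈D)             = DRoot-norm α∈D
E8-norm (inj₂ (ε , _ , refl))  = halfSigns-norm ε

E8-pairing : ∀ {α β} → E8Root α → E8Root β → Pairing (B α β)
E8-pairing (inj₁ α∈D) (inj₁ β∈D) = DRoot-pairing α∈D β∈D
E8-pairing (inj₁ (i , j , _ , s , t , refl)) (inj₂ (ε , _ , refl)) = DR-halfSigns-pairing s t i j ε
E8-pairing (inj₂ (ε , _ , refl)) (inj₁ (i , j , _ , s , t , refl)) =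
  subst Pairing (B-comm (DR s t i j) (halfSigns ε)) (DR-halfSigns-pairing s t i j ε)
E8-pairing (inj₂ (ε , ε-even , refl)) (inj₂ (ε' , ε'-even , refl)) = halfSigns-pairing ε ε' ε-even ε'-even

E8-neg : ∀ {α} → E8Root α → E8Root (neg α)
E8-neg (inj₁ α∈D)                 = inj₁ (DRoot-neg α∈D)
E8-neg (inj₂ (ε , ε-even , refl)) =
  inj₂ ((λ z → ε z Sign.* Sign.-) , even-* ε (λ _ → Sign.-) ε-even (divides 4 refl) , halfSigns-neg ε)

E8-sum : ∀ {α β} → E8Root α → E8Root β → B α β ≡ ℚ.- 1ℚ → E8Root (α ⊕ β)
E8-sum (inj₁ α∈D) (inj₁ β∈D) B≡-1 = inj₁ (DRoot-sum α∈D β∈D B≡-1)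
E8-sum (inj₁ (i , j , i≢j , s , t , refl)) (inj₂ (ε , ε-even , refl)) B≡-1 =
  inj₂ (DR-halfSigns-sum s t i j i≢j ε ε-even B≡-1)
E8-sum (inj₂ (ε , ε-even , refl)) (inj₁ (i , j , i≢j , s , t , refl)) B≡-1 =
  let (ε' , ε'-even , sum≡) = DR-halfSigns-sum s t i j i≢j ε ε-even (trans (B-comm (DR s t i j) (halfSigns ε)) B≡-1)
  in inj₂ (ε' , ε'-even , trans (⊕-comm (halfSigns ε) (DR s t i j)) sum≡)
E8-sum (inj₂ (ε , ε-even , refl)) (inj₂ (ε' , ε'-even , refl)) B≡-1 = inj₁ (halfSigns-sum ε ε' ε-even ε'-even B≡-1)

E8-isSimplyLaced : IsSimplyLacedRoots E8Root
E8-isSimplyLaced = record { norm = E8-norm ; pairing = E8-pairing ; neg-closed = E8-neg ; sum-closed = E8-sum }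

E7-isSimplyLaced : IsSimplyLacedRoots E7Root
E7-isSimplyLaced = record
  { norm       = E8-norm ∘ proj₁
  ; pairing    = λ (α∈ , _) (β∈ , _) → E8-pairing α∈ β∈
  ; neg-closed = λ {α} (α∈ , α⊥ω) → E8-neg α∈ , trans (B-negˡ α ω) (cong ℚ.-_ α⊥ω)
  ; sum-closed = λ {α} {β} (α∈ , α⊥ω) (β∈ , β⊥ω) B≡-1 → E8-sum α∈ β∈ B≡-1 , trans (B-⊕ˡ α β ω) (cong₂ ℚ._+_ α⊥ω β⊥ω)
  }

-- E₇ spans only ω⊥, so its 7 orthogonal roots are completed by ω to an orthogonal basis of ℚ⁸.
E7-expansion : ∀ (R : Fin 7 → V 8) → (∀ i → E7Root (R i)) → Orthogonal R → ∀ {α} → E7Root α → α ≡ lincomb R (coord R α)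
E7-expansion R R∈ orth {α} (α∈ , α⊥ω) = begin
  α
    ≡⟨ expansion ω∷R ω∷R-orthogonal ω∷R-norm α ⟩
  coord ω∷R α zero · ω ⊕ lincomb R (coord R α)
    ≡⟨ cong (λ c → c · ω ⊕ lincomb R (coord R α)) (trans (cong (½ ℚ.*_) α⊥ω) (ℚₚ.*-zeroʳ ½)) ⟩
  0ℚ · ω ⊕ lincomb R (coord R α)
    ≡⟨ cong (_⊕ lincomb R (coord R α)) (·-zeroˡ ω) ⟩
  𝟘 ⊕ lincomb R (coord R α)
    ≡⟨ ⊕-identityˡ _ ⟩
  lincomb R (coord R α) ∎
  where
  ω∷R : Fin 8 → V 8
  ω∷R zero    = ω
  ω∷R (suc i) = R i
  ω∷R-orthogonal : Orthogonal ω∷R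
  ω∷R-orthogonal zero    zero    0≢0 = ⊥-elim (0≢0 refl)
  ω∷R-orthogonal zero    (suc j) _   = trans (B-comm ω (R j)) (proj₂ (R∈ j))
  ω∷R-orthogonal (suc i) zero    _   = proj₂ (R∈ i)
  ω∷R-orthogonal (suc i) (suc j) i≢j = orth i j (i≢j ∘ cong suc)
  ω∷R-norm : ∀ i → B (ω∷R i) (ω∷R i) ≡ 2ℚ
  ω∷R-norm zero    = refl
  ω∷R-norm (suc i) = E8-norm (proj₁ (R∈ i))

isSimplyLaced : ∀ K → IsSimplyLacedRoots (Φ K)
isSimplyLaced E₇    = E7-isSimplyLaced
isSimplyLaced E₈    = E8-isSimplyLaced
isSimplyLaced (D n) = DRoot-isSimplyLaced

roots-expand : ∀ K (R : Fin (rank K) → V (dim K)) → (∀ i → Φ K (R i)) → Orthogonal R →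
               ∀ {α} → Φ K α → α ≡ lincomb R (coord R α)
roots-expand E₇    R R∈ orth         = E7-expansion R R∈ orth
roots-expand E₈    R R∈ orth {α} _   = expansion R orth (E8-norm ∘ R∈) α
roots-expand (D n) R R∈ orth {α} _   = expansion R orth (DRoot-norm ∘ R∈) α

proposition2p9 :
  (K : Kind) → Admissible K →
  (R : Fin (rank K) → V (dim K)) →
  (∀ i → Φ₊ K (R i)) →
  (∀ i j → i ≢ j → B (R i) (R j) ≡ 0ℚ) →
  -- (i)
  (∀ β → Φ₊ K β → (∀ i → β ≢ R i) →
    Σ (Subset (rank K)) λ Q →
      ∣ Q ∣ ≡ 4 ×
      (∀ i → i ∉ Q → B β (R i) ≡ 0ℚ) ×
      (∀ i → i ∈ Q → B β (R i) ≢ 0ℚ) ×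
      (Σ (Fin (rank K) → Sign) λ ε → β ≡ halfSumR R Q ε) ×
      SubsystemOfTypeD (Φ K) 4 (ΨQ R Q) ×
      (∀ i → i ∈ Q → ΨQ R Q (R i)) × ΨQ R Q β ×
      (∀ Ψ → IsSubsystem (Φ K) Ψ → (∀ i → i ∈ Q → Ψ (R i)) → Ψ β →
        ΨQ R Q ⊆ᵥ Ψ)) ×
  -- (ii)
  (∀ Q →
    ((Σ (V (dim K)) λ α → Φ K α × sumR R Q ≡ 2ℚ· α)
      ⇔ (Σ (V (dim K)) λ α → Φ K α × ¬ InR± R α × IsSupport R α Q)) ×
    ((Σ (V (dim K)) λ α → Φ K α × ¬ InR± R α × IsSupport R α Q)
      ⇔ Dk R (Φ K) 4 Q) ×
    (Dk R (Φ K) 4 Q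
      ⇔ (Σ (VSet (dim K)) λ Ψ → 𝒬 R (Φ K) Ψ × IsMeetR R Ψ Q))) ×
  -- (iii)
  (∀ Q → Dk R (Φ K) 4 Q →
    𝒬 R (Φ K) (SpanΦ R (Φ K) Q) × IsMeetR R (SpanΦ R (Φ K) Q) Q) ×
  (∀ Ψ → 𝒬 R (Φ K) Ψ → ∀ H → IsMeetR R Ψ H → SpanΦ R (Φ K) H ≐ Ψ) ×
  (∀ α → Φ K α → ¬ InR± R α →
    Σ (Subset (rank K)) λ Q →
      Dk R (Φ K) 4 Q × InSpan R Q α × IsSupport R α Q ×
      (∀ Q' → Dk R (Φ K) 4 Q' → InSpan R Q' α → Q' ≡ Q))
proposition2p9 K _ R R₊ orth =
  (λ β (Φβ , β₊) β≢R → quadruple-of-root β Φβ (positive-∉R± R (proj₂ ∘ R₊) β₊ β≢R)) ,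
  (λ Q → mk⇔ (double-sum⇒support Q) (support⇒double-sum Q) ,
         mk⇔ (support⇒D₄ Q) (D₄⇒support Q) ,
         mk⇔ (λ Q∈D₄ → SpanΦ R (Φ K) Q , D₄⇒𝒬 Q Q∈D₄) (𝒬⇒D₄ Q)) ,
  D₄⇒𝒬 , 𝒬≐SpanΦ , root-in-unique-D₄
  where
  R∈Φ : ∀ i → Φ K (R i)
  R∈Φ = proj₁ ∘ R₊
  open OrthogonalRootBasis (isSimplyLaced K) R R∈Φ orth (roots-expand K R R∈Φ orth)
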